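{- Let $r_1\ge r_2\ge -1$ be integers, $\kappa_1=(r_1,-r_2-2;r_1+r_2)$, and let $t_1,t_2\ge -1$ be integers with $t_1+t_2=r_1-r_2-2$; set $\tau=(t_1,t_2;r_1+r_2)$. Then there is a nonzero homomorphism of representations of the group $\gamma^{ -1}M_H\gamma$ \[ V^G_{\kappa_1}\big|_{\gamma^{ -1}M_H\gamma}\longrightarrow V^H_\tau,\] and it is unique up to scaling.
   Context: $G=\mathrm{GSp}_4$ (antidiagonal form with entries $(1,1,-1,-1)$ top-right to bottom-left), with Siegel Levi $M_G=\{\mathrm{diag}(A,\nu\, {}^{\text{adjusted}}A)\}\cong\mathrm{GL}_2\times\mathrm{GL}_1$ (block-diagonal elements of $G$ with $2\times2$ blocks) and upper-triangular Borel $B_G$. $H=\mathrm{GL}_2\times_{\mathrm{GL}_1}\mathrm{GL}_2$ embedded in $G$ by $\big(\begin{pmatrix}a&b\\c&d\end{pmatrix},\begin{pmatrix}a'&b'\\c'&d'\end{pmatrix}\big)\mapsto\begin{pmatrix}a&&&b\\&a'&b'&\\&c'&d'&\\c&&&d\end{pmatrix}$; $M_H=T$ is the diagonal torus of $H$, which is the diagonal torus of $G$. Characters of $T$ are triples $(a,b;c)$: $\mathrm{diag}(st_1,st_2,st_2^{ -1},st_1^{ -1})\mapsto t_1^at_2^bs^c$. $V^G_{\kappa}$ is the irreducible algebraic representation of $M_G$ of highest weight $\kappa$ with respect to $B_G\cap M_G$; $V^H_\tau$ is the one-dimensional representation of $M_H=T$ given by $\tau$. $\gamma=\begin{pmatrix}1&0&0&0\\1&1&0&0\\0&0&1&0\\0&0&-1&1\end{pmatrix}\in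 M_G$; the group $\gamma^{ -1}M_H\gamma\subset M_G$ acts on $V^G_{\kappa_1}$ by restriction and on $V^H_\tau$ via $m\mapsto\tau(\gamma m\gamma^{ -1})$. -}

module Defs where

open import Data.Nat as ℕ using (ℕ; zero; suc; _∸_)
open import Data.Integer as ℤ using (ℤ; +_; -[1+_])
open import Data.Rational as ℚ using (ℚ; 0ℚ; 1ℚ; _+_; _*_; -_; 1/_; _≟_; ≢-nonZero)
open import Data.List using (List; []; _∷_)
open import Data.Fin using (Fin; zero; suc; toℕ)
open import Data.Vec using (Vec; lookup; tabulate)
open import Relation.Nullary using (yes; no)
open import Relation.Binary.PropositionalEquality using (_≡_; _≢_)

-- total inverse (inv 0 = 0); only ever applied to nonzero arguments
inv : ℚ → ℚ
inv q with q ≟ 0ℚ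
... | yes _ = 0ℚ
... | no q≢0 = 1/_ q {{≢-nonZero q≢0}}

_^_ : ℚ → ℕ → ℚ
q ^ zero = 1ℚ
q ^ suc n = q * (q ^ n)

zpow : ℚ → ℤ → ℚ
zpow q (+ n) = q ^ n
zpow q -[1+ n ] = inv q ^ suc n

sumF : ∀ {n} → (Fin n → ℚ) → ℚ
sumF {zero} f = 0ℚ
sumF {suc n} f = f zero + sumF (λ i → f (suc i))

-- Univariate polynomials over ℚ as coefficient lists (constant term first).
-- A homogeneous polynomial of degree k in X,Y is identified with its
-- dehomogenisation at Y = 1: the coefficient of x^j is that of X^j Y^(k-j).

Poly : Set
Poly = List ℚ

_⊕_ : Poly → Poly → Poly
[] ⊕ q = q
(a ∷ p) ⊕ [] = a ∷ p
(a ∷ p) ⊕ (b ∷ q) = (a + b) ∷ (p ⊕ q)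

scaleP : ℚ → Poly → Poly
scaleP c [] = []
scaleP c (a ∷ p) = (c * a) ∷ scaleP c p

_⊛_ : Poly → Poly → Poly
[] ⊛ q = []
(a ∷ p) ⊛ q = scaleP a q ⊕ (0ℚ ∷ (p ⊛ q))

powP : Poly → ℕ → Poly
powP p zero = 1ℚ ∷ []
powP p (suc n) = p ⊛ powP p n

coeff : Poly → ℕ → ℚ
coeff [] n = 0ℚ
coeff (a ∷ p) zero = a
coeff (a ∷ p) (suc n) = coeff p n

-- The Siegel Levi M_G ≅ GL₂ × GL₁ :
-- (A , ν) ↦ diag(A , ν · S ᵗA⁻¹ S) with S = antidiag(1,1).
-- A = [[a , b] , [c , d]].

record MG : Set where
  constructor mg
  field
    a b c d : ℚ
    ν : ℚ

open MG public

detA : MG → ℚ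
detA g = a g * d g + - (b g * c g)

_·_ : MG → MG → MG
g · h = mg (a g * a h + b g * c h) (a g * b h + b g * d h)
           (c g * a h + d g * c h) (c g * b h + d g * d h)
           (ν g * ν h)

invMG : MG → MG
invMG g = mg (Δ * d g) (Δ * (- b g)) (Δ * (- c g)) (Δ * a g) (inv (ν g))
  where Δ = inv (detA g)

-- γ = [[1,0,0,0],[1,1,0,0],[0,0,1,0],[0,0,-1,1]] : A = [[1,0],[1,1]], ν = 1
γ : MG
γ = mg 1ℚ 0ℚ 1ℚ 1ℚ 1ℚ

-- the diagonal torus element diag(s t₁, s t₂, s t₂⁻¹, s t₁⁻¹)
torus : ℚ → ℚ → ℚ → MG
torus t₁ t₂ s = mg (s * t₁) 0ℚ 0ℚ (s * t₂) (s * s)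

-- character (a,b;c) of T evaluated at diag(s t₁, s t₂, s t₂⁻¹, s t₁⁻¹)
character : ℤ → ℤ → ℤ → ℚ → ℚ → ℚ → ℚ
character e₁ e₂ e₃ t₁ t₂ s = zpow t₁ e₁ * (zpow t₂ e₂ * zpow s e₃)

-- Sym^k of the standard representation of GL₂ on homogeneous polynomials
-- of degree k in X,Y:  (g·P)(X,Y) = P((X,Y) g),  basis X^i Y^(k-i) ↦ index i.
-- Its highest weight w.r.t. upper triangular matrices is (k,0) (vector X^k).

symImg : (k : ℕ) → MG → ℕ → Poly
symImg k g i = powP (c g ∷ a g ∷ []) i ⊛ powP (d g ∷ b g ∷ []) (k ∸ i)

symAct : (k : ℕ) → MG → Vec ℚ (suc k) → Vec ℚ (suc k)
symAct k g v = tabulate λ j →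
  sumF (λ i → lookup v i * coeff (symImg k g (toℕ i)) (toℕ j))

scaleV : ∀ {n} → ℚ → Vec ℚ n → Vec ℚ n
scaleV q v = tabulate λ j → q * lookup v j

addV : ∀ {n} → Vec ℚ n → Vec ℚ n → Vec ℚ n
addV u v = tabulate λ j → lookup u j + lookup v j

-- The irreducible representation V^G_κ of highest weight κ = (p, q; r)
-- (p ≥ q, p + q + r even) is  Sym^(p-q) ⊗ det^q ⊗ ν^((r-p-q)/2):
-- on diag(s t₁, s t₂) , ν = s², its highest weight vector X^(p-q) has weight
-- t₁^p t₂^q s^r.
dimG : ℤ → ℤ → ℕ
dimG p q = ℤ.∣ p ℤ.- q ∣

halfExp : ℤ → ℤ → ℤ → ℤ
halfExp p q r = (r ℤ.- p ℤ.- q) ℤ./ (+ 2)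

ρG : (p q r : ℤ) → MG → Vec ℚ (suc (dimG p q)) → Vec ℚ (suc (dimG p q))
ρG p q r g v = scaleV (zpow (detA g) q * zpow (ν g) (halfExp p q r)) (symAct (dimG p q) g v)

-- Homomorphisms of representations of γ⁻¹ M_H γ from V^G_κ (restricted)
-- to the one-dimensional V^H_τ, on which m acts by τ(γ m γ⁻¹).
-- Elements of γ⁻¹ M_H γ are γ⁻¹ t γ for t in the torus T = M_H.

record IsHom (p q r : ℤ) (e₁ e₂ e₃ : ℤ) (φ : Vec ℚ (suc (dimG p q)) → ℚ) : Set where
  field
    additive : ∀ u v → φ (addV u v) ≡ φ u + φ v
    homogeneous : ∀ x v → φ (scaleV x v) ≡ x * φ v
    equivariant : ∀ t₁ t₂ s → t₁ ≢ 0ℚ → t₂ ≢ 0ℚ → s ≢ 0ℚ → ∀ v →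
      φ (ρG p q r (invMG γ · (torus t₁ t₂ s · γ)) v)
        ≡ character e₁ e₂ e₃ t₁ t₂ s * φ v

-- On Sym^k ⊗ det^q ⊗ ν^h the element γ⁻¹ diag(sx, sy) γ sends X ↦ sx·X + (sy − sx)·Y and
-- Y ↦ sy·Y, so the (X − Y)ˡ Yᵏ⁻ˡ form an eigenbasis with eigenvalues det^q ν^h (sx)ˡ (sy)ᵏ⁻ˡ,
-- which for l = t₁ − q is the character τ. In the variable x = X/Y the coordinate along
-- (x − 1)ˡ is the l-th Taylor coefficient at 1; at l = t₁ − q it is the required nonzero
-- homomorphism. Conversely a linear φ is determined by its values on this basis, and
-- equivariance under γ⁻¹ diag(2, 1) γ alone, whose eigenvalues (scalar)·2ˡ are pairwise
-- distinct, forces every value except the one at l = t₁ − q to vanish.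
module Submission where

open import Defs

-- ℚ's arithmetic is opened only inside this module, because the theorem at the end is stated
-- with ℤ's _+_, _-_ and -_.
module _ where
  open import Level using (0ℓ)
  open import Algebra.Bundles using (CommutativeMonoid; CommutativeRing)
  open import Data.Empty using (⊥-elim)
  open import Data.Fin using (Fin; toℕ) renaming (zero to fzero; suc to fsuc)
  import Data.Fin.Properties as Finₚ
  open import Data.Integer as ℤ using (ℤ; +_; -[1+_]; 0ℤ)
  import Data.Integer.Properties as ℤ
  import Data.Integer.Tactic.RingSolver as ℤ-Solver
  open import Data.List using ([]; _∷_; length)
  open import Data.Maybe using (Maybe; just; nothing)
  open import Data.Nat as ℕ using (ℕ; zero; suc; _≤_; _<_; _∸_; z≤n; s≤s)
  import Data.Nat.Properties as ℕ
  open import Data.Product using (Σ; ∃; _×_; _,_)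
  open import Data.Rational using (ℚ; 0ℚ; 1ℚ; _+_; _*_; -_; _≟_; ≢-nonZero) renaming (_<_ to _<ℚ_)
  import Data.Rational.Properties as ℚ
  open import Data.Sum using (inj₁; inj₂)
  open import Data.Vec using (Vec; lookup; tabulate; toList) renaming (_∷_ to _∷ᵥ_; [] to []ᵥ)
  open import Data.Vec.Properties using (lookup∘tabulate; tabulate∘lookup; tabulate-cong; length-toList)
  open import Function using (_∘_)
  open import Relation.Binary.Definitions using (tri<; tri≈; tri>)
  open import Relation.Binary.PropositionalEquality
  open import Relation.Nullary using (yes; no)
  open import Tactic.RingSolver using (solve-∀)
  import Tactic.RingSolver.Core.AlmostCommutativeRing as ACR

  open import Algebra.Properties.CommutativeSemigroup
    (CommutativeMonoid.commutativeSemigroup ℚ.+-0-commutativeMonoid)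
    using () renaming (interchange to +-interchange)
  open import Algebra.Properties.Semiring.Sum (CommutativeRing.semiring ℚ.+-*-commutativeRing)
    using (sum; sum-syntax; sum-cong-≗; ∑-distrib-+; ∑-comm; *-distribˡ-sum; *-distribʳ-sum)

  ℚ-ring : ACR.AlmostCommutativeRing 0ℓ 0ℓ
  ℚ-ring = ACR.fromCommutativeRing ℚ.+-*-commutativeRing 0≟
    where
    0≟ : ∀ x → Maybe (0ℚ ≡ x)
    0≟ x with 0ℚ ≟ x
    ... | yes p = just p
    ... | no _  = nothing

  inv-inverseˡ : ∀ q → q ≢ 0ℚ → inv q * q ≡ 1ℚ
  inv-inverseˡ q q≢0 with q ≟ 0ℚ
  ... | yes q≡0 = ⊥-elim (q≢0 q≡0)
  ... | no q≢0′ = ℚ.*-inverseˡ q {{≢-nonZero q≢0′}}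

  *-cancelˡ-≢0 : ∀ x {y z} → x ≢ 0ℚ → x * y ≡ x * z → y ≡ z
  *-cancelˡ-≢0 x {y} {z} x≢0 eq = begin
    y                 ≡⟨ reassoc y ⟩
    inv x * (x * y)   ≡⟨ cong (inv x *_) eq ⟩
    inv x * (x * z)   ≡⟨ reassoc z ⟨
    z                 ∎
    where
    open ≡-Reasoning
    reassoc : ∀ w → w ≡ inv x * (x * w)
    reassoc w = begin
      w                  ≡⟨ ℚ.*-identityˡ w ⟨
      1ℚ * w             ≡⟨ cong (_* w) (inv-inverseˡ x x≢0) ⟨
      (inv x * x) * w    ≡⟨ ℚ.*-assoc (inv x) x w ⟩
      inv x * (x * w)    ∎

  *-≢0 : ∀ {x y} → x ≢ 0ℚ → y ≢ 0ℚ → x * y ≢ 0ℚ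
  *-≢0 {x} {y} x≢0 y≢0 xy≡0 = y≢0 (*-cancelˡ-≢0 x x≢0 (trans xy≡0 (sym (ℚ.*-zeroʳ x))))

  x*z≡y*z⇒z≡0 : ∀ {x y} z → x * z ≡ y * z → x ≢ y → z ≡ 0ℚ
  x*z≡y*z⇒z≡0 {x} {y} z eq x≢y with z ≟ 0ℚ
  ... | yes z≡0 = z≡0
  ... | no z≢0  = ⊥-elim (x≢y (*-cancelˡ-≢0 z z≢0 (trans (ℚ.*-comm z x) (trans eq (ℚ.*-comm y z)))))

  inv-≢0 : ∀ {q} → q ≢ 0ℚ → inv q ≢ 0ℚ
  inv-≢0 {q} q≢0 inv≡0 = ℚ.1≢0 (trans (sym (inv-inverseˡ q q≢0)) (trans (cong (_* q) inv≡0) (ℚ.*-zeroˡ q)))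

  inv-distrib-* : ∀ {x y} → x ≢ 0ℚ → y ≢ 0ℚ → inv (x * y) ≡ inv x * inv y
  inv-distrib-* {x} {y} x≢0 y≢0 = *-cancelˡ-≢0 (x * y) (*-≢0 x≢0 y≢0) (begin
    (x * y) * inv (x * y)        ≡⟨ ℚ.*-comm (x * y) _ ⟩
    inv (x * y) * (x * y)        ≡⟨ inv-inverseˡ (x * y) (*-≢0 x≢0 y≢0) ⟩
    1ℚ                           ≡⟨ cong₂ _*_ (inv-inverseˡ x x≢0) (inv-inverseˡ y y≢0) ⟨
    (inv x * x) * (inv y * y)    ≡⟨ interchange (inv x) x (inv y) y ⟩
    (x * y) * (inv x * inv y)    ∎)
    where
    open ≡-Reasoning
    interchange : ∀ a b c d → (a * b) * (c * d) ≡ (b * d) * (a * c)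
    interchange = solve-∀ ℚ-ring

  ^-≢0 : ∀ {x} n → x ≢ 0ℚ → x ^ n ≢ 0ℚ
  ^-≢0 zero    x≢0 = ℚ.1≢0
  ^-≢0 (suc n) x≢0 = *-≢0 x≢0 (^-≢0 n x≢0)

  ^-homo-+ : ∀ x m n → x ^ (m ℕ.+ n) ≡ x ^ m * x ^ n
  ^-homo-+ x zero    n = sym (ℚ.*-identityˡ (x ^ n))
  ^-homo-+ x (suc m) n = trans (cong (x *_) (^-homo-+ x m n)) (sym (ℚ.*-assoc x (x ^ m) (x ^ n)))

  ^-distrib-* : ∀ x y n → (x * y) ^ n ≡ x ^ n * y ^ n
  ^-distrib-* x y zero    = refl
  ^-distrib-* x y (suc n) = trans (cong ((x * y) *_) (^-distrib-* x y n)) (interchange x y (x ^ n) (y ^ n))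
    where
    interchange : ∀ a b c d → (a * b) * (c * d) ≡ (a * c) * (b * d)
    interchange = solve-∀ ℚ-ring

  ^-zeroˡ : ∀ n → 1ℚ ^ n ≡ 1ℚ
  ^-zeroˡ zero    = refl
  ^-zeroˡ (suc n) = trans (ℚ.*-identityˡ (1ℚ ^ n)) (^-zeroˡ n)

  zpow-≢0 : ∀ {x} n → x ≢ 0ℚ → zpow x n ≢ 0ℚ
  zpow-≢0 (+ n)    x≢0 = ^-≢0 n x≢0
  zpow-≢0 -[1+ n ] x≢0 = ^-≢0 (suc n) (inv-≢0 x≢0)

  zpow-⊖ : ∀ {x} m n → x ≢ 0ℚ → zpow x (m ℤ.⊖ n) ≡ x ^ m * inv x ^ n
  zpow-⊖     zero    zero    x≢0 = refl
  zpow-⊖ {x} (suc m) zero    x≢0 = sym (ℚ.*-identityʳ (x ^ suc m))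
  zpow-⊖ {x} zero    (suc n) x≢0 = sym (ℚ.*-identityˡ (inv x ^ suc n))
  zpow-⊖ {x} (suc m) (suc n) x≢0 = begin
    zpow x (suc m ℤ.⊖ suc n)                 ≡⟨ cong (zpow x) (ℤ.[1+m]⊖[1+n]≡m⊖n m n) ⟩
    zpow x (m ℤ.⊖ n)                         ≡⟨ zpow-⊖ m n x≢0 ⟩
    x ^ m * inv x ^ n                        ≡⟨ ℚ.*-identityˡ _ ⟨
    1ℚ * (x ^ m * inv x ^ n)                 ≡⟨ cong (_* (x ^ m * inv x ^ n)) (inv-inverseˡ x x≢0) ⟨
    (inv x * x) * (x ^ m * inv x ^ n)        ≡⟨ interchange (inv x) x (x ^ m) (inv x ^ n) ⟩
    (x * x ^ m) * (inv x * inv x ^ n)        ∎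
    where
    open ≡-Reasoning
    interchange : ∀ a b c d → (a * b) * (c * d) ≡ (b * c) * (a * d)
    interchange = solve-∀ ℚ-ring

  zpow-homo-+ : ∀ {x} m n → x ≢ 0ℚ → zpow x (m ℤ.+ n) ≡ zpow x m * zpow x n
  zpow-homo-+ {x} (+ m)    (+ n)    x≢0 = ^-homo-+ x m n
  zpow-homo-+ {x} (+ m)    -[1+ n ] x≢0 = zpow-⊖ m (suc n) x≢0
  zpow-homo-+ {x} -[1+ m ] (+ n)    x≢0 = trans (zpow-⊖ n (suc m) x≢0) (ℚ.*-comm (x ^ n) _)
  zpow-homo-+ {x} -[1+ m ] -[1+ n ] x≢0 = begin
    inv x * inv x ^ suc (m ℕ.+ n)            ≡⟨ cong (λ e → inv x * inv x ^ e) (ℕ.+-suc m n) ⟨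
    inv x * inv x ^ (m ℕ.+ suc n)            ≡⟨ cong (inv x *_) (^-homo-+ (inv x) m (suc n)) ⟩
    inv x * (inv x ^ m * inv x ^ suc n)      ≡⟨ ℚ.*-assoc (inv x) _ _ ⟨
    (inv x * inv x ^ m) * inv x ^ suc n      ∎
    where open ≡-Reasoning

  zpow-distrib-* : ∀ {x y} n → x ≢ 0ℚ → y ≢ 0ℚ → zpow (x * y) n ≡ zpow x n * zpow y n
  zpow-distrib-* {x} {y} (+ n)    x≢0 y≢0 = ^-distrib-* x y n
  zpow-distrib-* {x} {y} -[1+ n ] x≢0 y≢0 =
    trans (cong (_^ suc n) (inv-distrib-* x≢0 y≢0)) (^-distrib-* (inv x) (inv y) (suc n))

  two : ℚ
  two = 1ℚ + 1ℚ

  two^n<two^[1+n] : ∀ n → two ^ n <ℚ two ^ suc n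
  0<two^n : ∀ n → 0ℚ <ℚ two ^ n

  two^n<two^[1+n] n = subst (two ^ n <ℚ_) (sym (double (two ^ n)))
    (subst (_<ℚ two ^ n + two ^ n) (ℚ.+-identityʳ (two ^ n)) (ℚ.+-monoʳ-< (two ^ n) (0<two^n n)))
    where
    double : ∀ y → (1ℚ + 1ℚ) * y ≡ y + y
    double = solve-∀ ℚ-ring

  0<two^n zero    = ℚ.positive⁻¹ 1ℚ
  0<two^n (suc n) = ℚ.<-trans (0<two^n n) (two^n<two^[1+n] n)

  two^-strictMono : ∀ {m n} → m ℕ.< n → two ^ m <ℚ two ^ n
  two^-strictMono {m} {suc n} (s≤s m≤n) with ℕ.m≤n⇒m<n∨m≡n m≤n
  ... | inj₁ m<n  = ℚ.<-trans (two^-strictMono m<n) (two^n<two^[1+n] n)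
  ... | inj₂ refl = two^n<two^[1+n] m

  two^-injective : ∀ {m n} → two ^ m ≡ two ^ n → m ≡ n
  two^-injective {m} {n} eq with ℕ.<-cmp m n
  ... | tri< m<n _ _ = ⊥-elim (ℚ.<⇒≢ (two^-strictMono m<n) eq)
  ... | tri≈ _ m≡n _ = m≡n
  ... | tri> _ _ n<m = ⊥-elim (ℚ.<⇒≢ (two^-strictMono n<m) (sym eq))

  two≢0 : two ≢ 0ℚ
  two≢0 ()

  sumF≡sum : ∀ {n} (f : Fin n → ℚ) → sumF f ≡ sum f
  sumF≡sum {zero}  f = refl
  sumF≡sum {suc n} f = cong (_+_ (f fzero)) (sumF≡sum (f ∘ fsuc))

  sum-zero : ∀ {n} (f : Fin n → ℚ) → (∀ j → f j ≡ 0ℚ) → sum f ≡ 0ℚ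
  sum-zero {zero}  f f≡0 = refl
  sum-zero {suc n} f f≡0 = cong₂ _+_ (f≡0 fzero) (sum-zero (f ∘ fsuc) (f≡0 ∘ fsuc))

  sum-single : ∀ {n} (f : ℕ → ℚ) i → i < n →
    (∀ j → j < n → j ≢ i → f j ≡ 0ℚ) → ∑[ j < n ] f (toℕ j) ≡ f i
  sum-single {suc n} f zero    _         f≡0 = begin
    f 0 + ∑[ j < n ] f (suc (toℕ j))
      ≡⟨ cong (_+_ (f 0)) (sum-zero _ (λ j → f≡0 _ (s≤s (Finₚ.toℕ<n j)) λ ())) ⟩
    f 0 + 0ℚ
      ≡⟨ ℚ.+-identityʳ (f 0) ⟩
    f 0  ∎
    where open ≡-Reasoning
  sum-single {suc n} f (suc i) (s≤s i<n) f≡0 = begin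
    f 0 + ∑[ j < n ] f (suc (toℕ j))
      ≡⟨ cong₂ _+_ (f≡0 0 (s≤s z≤n) λ ()) (sum-single (f ∘ suc) i i<n f∘suc≡0) ⟩
    0ℚ + f (suc i)
      ≡⟨ ℚ.+-identityˡ (f (suc i)) ⟩
    f (suc i)  ∎
    where
    open ≡-Reasoning
    f∘suc≡0 : ∀ j → j < n → j ≢ i → f (suc j) ≡ 0ℚ
    f∘suc≡0 j j<n j≢i = f≡0 (suc j) (s≤s j<n) (j≢i ∘ ℕ.suc-injective)

  coeff-⊕ : ∀ p q n → coeff (p ⊕ q) n ≡ coeff p n + coeff q n
  coeff-⊕ []      q       n       = sym (ℚ.+-identityˡ (coeff q n))
  coeff-⊕ (a ∷ p) []      n       = sym (ℚ.+-identityʳ (coeff (a ∷ p) n))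
  coeff-⊕ (a ∷ p) (b ∷ q) zero    = refl
  coeff-⊕ (a ∷ p) (b ∷ q) (suc n) = coeff-⊕ p q n

  coeff-scaleP : ∀ c p n → coeff (scaleP c p) n ≡ c * coeff p n
  coeff-scaleP c []      n       = sym (ℚ.*-zeroʳ c)
  coeff-scaleP c (a ∷ p) zero    = refl
  coeff-scaleP c (a ∷ p) (suc n) = coeff-scaleP c p n

  DegreeBelow : ℕ → Poly → Set
  DegreeBelow N p = ∀ n → N ≤ n → coeff p n ≡ 0ℚ

  DegreeBelow-mono : ∀ {M N} p → M ≤ N → DegreeBelow M p → DegreeBelow N p
  DegreeBelow-mono p M≤N deg n N≤n = deg n (ℕ.≤-trans M≤N N≤n)

  DegreeBelow-tail : ∀ {N a} p → DegreeBelow (suc N) (a ∷ p) → DegreeBelow N p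
  DegreeBelow-tail p deg n N≤n = deg (suc n) (s≤s N≤n)

  coeff-⊛-cons : ∀ a p q n →
    coeff ((a ∷ p) ⊛ q) n ≡ a * coeff q n + coeff (0ℚ ∷ (p ⊛ q)) n
  coeff-⊛-cons a p q n = trans (coeff-⊕ (scaleP a q) _ n) (cong (_+ _) (coeff-scaleP a q n))

  DegreeBelow-zero-⊛ : ∀ p q → DegreeBelow 0 p → DegreeBelow 0 (p ⊛ q)
  DegreeBelow-zero-⊛ []      q deg n       _ = refl
  DegreeBelow-zero-⊛ (a ∷ p) q deg n       _ = begin
    coeff ((a ∷ p) ⊛ q) n                  ≡⟨ coeff-⊛-cons a p q n ⟩
    a * coeff q n + coeff (0ℚ ∷ (p ⊛ q)) n ≡⟨ cong₂ _+_ (cong (_* coeff q n) (deg 0 z≤n)) (shifted n) ⟩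
    0ℚ * coeff q n + 0ℚ                    ≡⟨ cong (_+ 0ℚ) (ℚ.*-zeroˡ (coeff q n)) ⟩
    0ℚ                                     ∎
    where
    open ≡-Reasoning
    shifted : ∀ n → coeff (0ℚ ∷ (p ⊛ q)) n ≡ 0ℚ
    shifted zero    = refl
    shifted (suc n) = DegreeBelow-zero-⊛ p q (λ m _ → deg (suc m) z≤n) n z≤n

  DegreeBelow-⊛ : ∀ {N M} p q → DegreeBelow (suc N) p → DegreeBelow M q →
    DegreeBelow (N ℕ.+ M) (p ⊛ q)
  DegreeBelow-⊛         []      q degp degq n _ = refl
  DegreeBelow-⊛ {N} {M} (a ∷ p) q degp degq n N+M≤n = begin
    coeff ((a ∷ p) ⊛ q) n
      ≡⟨ coeff-⊛-cons a p q n ⟩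
    a * coeff q n + coeff (0ℚ ∷ (p ⊛ q)) n
      ≡⟨ cong₂ _+_ (cong (a *_) (degq n (ℕ.≤-trans (ℕ.m≤n+m M N) N+M≤n)))
                   (shifted N n N+M≤n (DegreeBelow-tail p degp)) ⟩
    a * 0ℚ + 0ℚ
      ≡⟨ cong (_+ 0ℚ) (ℚ.*-zeroʳ a) ⟩
    0ℚ  ∎
    where
    open ≡-Reasoning
    shifted : ∀ N n → N ℕ.+ M ≤ n → DegreeBelow N p → coeff (0ℚ ∷ (p ⊛ q)) n ≡ 0ℚ
    shifted N       zero    _           _    = refl
    shifted zero    (suc n) _           degp = DegreeBelow-zero-⊛ p q degp n z≤n
    shifted (suc N) (suc n) (s≤s N+M≤n) degp = DegreeBelow-⊛ p q degp degq n N+M≤n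

  DegreeBelow-powP : ∀ c a n → DegreeBelow (suc n) (powP (c ∷ a ∷ []) n)
  DegreeBelow-powP c a zero    (suc m) _ = refl
  DegreeBelow-powP c a (suc n) = DegreeBelow-⊛ (c ∷ a ∷ []) (powP (c ∷ a ∷ []) n) linear (DegreeBelow-powP c a n)
    where
    linear : DegreeBelow 2 (c ∷ a ∷ [])
    linear (suc (suc m)) _         = refl
    linear (suc zero)    (s≤s ())

  -- Taylor coefficients at 1

  binom : ℕ → ℕ → ℚ
  binom j       zero    = 1ℚ
  binom zero    (suc l) = 0ℚ
  binom (suc j) (suc l) = binom j l + binom j (suc l)

  binom-vanish : ∀ {j l} → j < l → binom j l ≡ 0ℚ
  binom-vanish {zero}  {suc l} _         = refl
  binom-vanish {suc j} {suc l} (s≤s j<l) =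
    cong₂ _+_ (binom-vanish j<l) (binom-vanish (ℕ.m≤n⇒m≤1+n j<l))

  -- The coefficient of (x − 1)ˡ when p is expanded about 1; the recursion
  -- comes from a + x·p = a + p + (x − 1)·p.
  taylorCoeff : Poly → ℕ → ℚ
  taylorCoeff []      l       = 0ℚ
  taylorCoeff (a ∷ p) zero    = a + taylorCoeff p zero
  taylorCoeff (a ∷ p) (suc l) = taylorCoeff p l + taylorCoeff p (suc l)

  taylorCoeff-⊕ : ∀ p q l → taylorCoeff (p ⊕ q) l ≡ taylorCoeff p l + taylorCoeff q l
  taylorCoeff-⊕ []      q       l       = sym (ℚ.+-identityˡ _)
  taylorCoeff-⊕ (a ∷ p) []      l       = sym (ℚ.+-identityʳ _)
  taylorCoeff-⊕ (a ∷ p) (b ∷ q) zero    =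
    trans (cong (_+_ (a + b)) (taylorCoeff-⊕ p q zero)) (+-interchange a b _ _)
  taylorCoeff-⊕ (a ∷ p) (b ∷ q) (suc l) =
    trans (cong₂ _+_ (taylorCoeff-⊕ p q l) (taylorCoeff-⊕ p q (suc l)))
          (+-interchange (taylorCoeff p l) (taylorCoeff q l) _ _)

  taylorCoeff-scaleP : ∀ c p l → taylorCoeff (scaleP c p) l ≡ c * taylorCoeff p l
  taylorCoeff-scaleP c []      l       = sym (ℚ.*-zeroʳ c)
  taylorCoeff-scaleP c (a ∷ p) zero    =
    trans (cong (_+_ (c * a)) (taylorCoeff-scaleP c p zero)) (sym (ℚ.*-distribˡ-+ c a _))
  taylorCoeff-scaleP c (a ∷ p) (suc l) =
    trans (cong₂ _+_ (taylorCoeff-scaleP c p l) (taylorCoeff-scaleP c p (suc l))) (sym (ℚ.*-distribˡ-+ c _ _))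

  taylorCoeff-zero : ∀ p → DegreeBelow 0 p → ∀ l → taylorCoeff p l ≡ 0ℚ
  taylorCoeff-zero []      deg l       = refl
  taylorCoeff-zero (a ∷ p) deg l = cons l
    where
    deg′ : DegreeBelow 0 p
    deg′ = DegreeBelow-tail p (DegreeBelow-mono (a ∷ p) z≤n deg)
    cons : ∀ l → taylorCoeff (a ∷ p) l ≡ 0ℚ
    cons zero    = cong₂ _+_ (deg 0 z≤n) (taylorCoeff-zero p deg′ zero)
    cons (suc l) = cong₂ _+_ (taylorCoeff-zero p deg′ l) (taylorCoeff-zero p deg′ (suc l))

  taylorCoeff-binomial-sum : ∀ {N} p → DegreeBelow N p → ∀ l →
    ∑[ j < N ] (coeff p (toℕ j) * binom (toℕ j) l) ≡ taylorCoeff p l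
  taylorCoeff-binomial-sum {zero}  p       deg l       = sym (taylorCoeff-zero p deg l)
  taylorCoeff-binomial-sum {suc N} []      deg l       = sum-zero {suc N} _ (λ j → ℚ.*-zeroˡ (binom (toℕ j) l))
  taylorCoeff-binomial-sum {suc N} (a ∷ p) deg zero    =
    cong₂ _+_ (ℚ.*-identityʳ a) (taylorCoeff-binomial-sum p (DegreeBelow-tail p deg) zero)
  taylorCoeff-binomial-sum {suc N} (a ∷ p) deg (suc l) = begin
    a * 0ℚ + ∑[ j < N ] (coeff p (toℕ j) * (binom (toℕ j) l + binom (toℕ j) (suc l)))
      ≡⟨ cong₂ _+_ (ℚ.*-zeroʳ a) (sum-cong-≗ {N} (λ j → ℚ.*-distribˡ-+ (coeff p (toℕ j)) _ _)) ⟩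
    0ℚ + ∑[ j < N ] (coeff p (toℕ j) * binom (toℕ j) l + coeff p (toℕ j) * binom (toℕ j) (suc l))
      ≡⟨ ℚ.+-identityˡ _ ⟩
    ∑[ j < N ] (coeff p (toℕ j) * binom (toℕ j) l + coeff p (toℕ j) * binom (toℕ j) (suc l))
      ≡⟨ ∑-distrib-+ {N} (λ j → coeff p (toℕ j) * binom (toℕ j) l) _ ⟩
    ∑[ j < N ] (coeff p (toℕ j) * binom (toℕ j) l) + ∑[ j < N ] (coeff p (toℕ j) * binom (toℕ j) (suc l))
      ≡⟨ cong₂ _+_ (taylorCoeff-binomial-sum p deg′ l) (taylorCoeff-binomial-sum p deg′ (suc l)) ⟩
    taylorCoeff p l + taylorCoeff p (suc l)  ∎
    where
    open ≡-Reasoning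
    deg′ : DegreeBelow N p
    deg′ = DegreeBelow-tail p deg

  taylorCoeff-cons : ∀ a p l → taylorCoeff (a ∷ p) l ≡ a * binom 0 l + taylorCoeff (0ℚ ∷ p) l
  taylorCoeff-cons a p zero    = cong₂ _+_ (sym (ℚ.*-identityʳ a)) (sym (ℚ.+-identityˡ _))
  taylorCoeff-cons a p (suc l) = sym (trans (cong (_+ _) (ℚ.*-zeroʳ a)) (ℚ.+-identityˡ _))

  taylorCoeff-shift-scale : ∀ {p q} e → (∀ m → taylorCoeff p m ≡ e * taylorCoeff q m) →
    ∀ l → taylorCoeff (0ℚ ∷ p) l ≡ e * taylorCoeff (0ℚ ∷ q) l
  taylorCoeff-shift-scale e p≡eq zero    =
    trans (ℚ.+-identityˡ _) (trans (p≡eq zero) (cong (e *_) (sym (ℚ.+-identityˡ _))))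
  taylorCoeff-shift-scale e p≡eq (suc l) =
    trans (cong₂ _+_ (p≡eq l) (p≡eq (suc l))) (sym (ℚ.*-distribˡ-+ e _ _))

  taylorCoeff-⊛-cons : ∀ a p q l →
    taylorCoeff ((a ∷ p) ⊛ q) l ≡ a * taylorCoeff q l + taylorCoeff (0ℚ ∷ (p ⊛ q)) l
  taylorCoeff-⊛-cons a p q l =
    trans (taylorCoeff-⊕ (scaleP a q) (0ℚ ∷ (p ⊛ q)) l) (cong (_+ _) (taylorCoeff-scaleP a q l))

  taylorCoeff-linear-⊛ : ∀ c a q l →
    taylorCoeff ((c ∷ a ∷ []) ⊛ q) l ≡ c * taylorCoeff q l + a * taylorCoeff (0ℚ ∷ q) l
  taylorCoeff-linear-⊛ c a q l =
    trans (taylorCoeff-⊛-cons c (a ∷ []) q l) (cong (_+_ (c * taylorCoeff q l)) (taylorCoeff-shift-scale a aq l))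
    where
    zero-poly : ∀ m → taylorCoeff (0ℚ ∷ []) m ≡ 0ℚ
    zero-poly zero    = refl
    zero-poly (suc m) = refl
    aq : ∀ m → taylorCoeff ((a ∷ []) ⊛ q) m ≡ a * taylorCoeff q m
    aq m = trans (taylorCoeff-⊛-cons a [] q m)
                 (trans (cong (_+_ (a * taylorCoeff q m)) (zero-poly m)) (ℚ.+-identityʳ _))

  taylorCoeff-⊛-constant : ∀ {q} e → (∀ m → taylorCoeff q m ≡ e * binom 0 m) →
    ∀ p l → taylorCoeff (p ⊛ q) l ≡ e * taylorCoeff p l
  taylorCoeff-⊛-constant e q≡e []      l = sym (ℚ.*-zeroʳ e)
  taylorCoeff-⊛-constant {q} e q≡e (a ∷ p) l = begin
    taylorCoeff ((a ∷ p) ⊛ q) l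
      ≡⟨ taylorCoeff-⊛-cons a p q l ⟩
    a * taylorCoeff q l + taylorCoeff (0ℚ ∷ (p ⊛ q)) l
      ≡⟨ cong₂ _+_ (cong (a *_) (q≡e l)) (taylorCoeff-shift-scale e (taylorCoeff-⊛-constant e q≡e p) l) ⟩
    a * (e * binom 0 l) + e * taylorCoeff (0ℚ ∷ p) l
      ≡⟨ factor a e (binom 0 l) _ ⟩
    e * (a * binom 0 l + taylorCoeff (0ℚ ∷ p) l)
      ≡⟨ cong (e *_) (taylorCoeff-cons a p l) ⟨
    e * taylorCoeff (a ∷ p) l  ∎
    where
    open ≡-Reasoning
    factor : ∀ a e b t → a * (e * b) + e * t ≡ e * (a * b + t)
    factor = solve-∀ ℚ-ring

  taylorCoeff-powP-constant : ∀ {d b} → b ≡ 0ℚ → ∀ m l →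
    taylorCoeff (powP (d ∷ b ∷ []) m) l ≡ d ^ m * binom 0 l
  taylorCoeff-powP-constant b≡0 zero    zero    = refl
  taylorCoeff-powP-constant b≡0 zero    (suc l) = refl
  taylorCoeff-powP-constant {d} {b} b≡0 (suc m) l = begin
    taylorCoeff ((d ∷ b ∷ []) ⊛ R) l
      ≡⟨ taylorCoeff-linear-⊛ d b R l ⟩
    d * taylorCoeff R l + b * taylorCoeff (0ℚ ∷ R) l
      ≡⟨ cong₂ _+_ (cong (d *_) (taylorCoeff-powP-constant b≡0 m l)) (cong (_* taylorCoeff (0ℚ ∷ R) l) b≡0) ⟩
    d * (d ^ m * binom 0 l) + 0ℚ * taylorCoeff (0ℚ ∷ R) l
      ≡⟨ cleanup d (d ^ m) (binom 0 l) (taylorCoeff (0ℚ ∷ R) l) ⟩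
    (d * d ^ m) * binom 0 l  ∎
    where
    open ≡-Reasoning
    R : Poly
    R = powP (d ∷ b ∷ []) m
    cleanup : ∀ d D c t → d * (D * c) + 0ℚ * t ≡ (d * D) * c
    cleanup = solve-∀ ℚ-ring

  -- For l > n the binomial factor vanishes, which makes up for the truncated subtraction n ∸ l.
  *-^-∸-binom : ∀ d {i n} l → i ≤ n → d * (d ^ (n ∸ l) * binom i l) ≡ d ^ (suc n ∸ l) * binom i l
  *-^-∸-binom d {i} {n} l i≤n with l ℕ.≤? n
  ... | yes l≤n = trans (sym (ℚ.*-assoc d _ _)) (cong (λ e → d ^ e * binom i l) (sym (ℕ.+-∸-assoc 1 l≤n)))
  ... | no  l≰n = begin
    d * (d ^ (n ∸ l) * binom i l)  ≡⟨ cong (λ c → d * (d ^ (n ∸ l) * c)) binom≡0 ⟩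
    d * (d ^ (n ∸ l) * 0ℚ)         ≡⟨ cong (d *_) (ℚ.*-zeroʳ (d ^ (n ∸ l))) ⟩
    d * 0ℚ                         ≡⟨ ℚ.*-zeroʳ d ⟩
    0ℚ                             ≡⟨ ℚ.*-zeroʳ (d ^ (suc n ∸ l)) ⟨
    d ^ (suc n ∸ l) * 0ℚ           ≡⟨ cong (d ^ (suc n ∸ l) *_) binom≡0 ⟨
    d ^ (suc n ∸ l) * binom i l    ∎
    where
    open ≡-Reasoning
    binom≡0 : binom i l ≡ 0ℚ
    binom≡0 = binom-vanish (ℕ.≤-<-trans i≤n (ℕ.≰⇒> l≰n))

  ^-*-^-∸-binom : ∀ d {i n} m l → i ≤ n →
    d ^ m * (d ^ (n ∸ l) * binom i l) ≡ d ^ (m ℕ.+ n ∸ l) * binom i l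
  ^-*-^-∸-binom d zero    l i≤n = ℚ.*-identityˡ _
  ^-*-^-∸-binom d (suc m) l i≤n = begin
    (d * d ^ m) * (d ^ (_ ∸ l) * binom _ l)  ≡⟨ ℚ.*-assoc d (d ^ m) _ ⟩
    d * (d ^ m * (d ^ (_ ∸ l) * binom _ l))  ≡⟨ cong (d *_) (^-*-^-∸-binom d m l i≤n) ⟩
    d * (d ^ (m ℕ.+ _ ∸ l) * binom _ l)      ≡⟨ *-^-∸-binom d l (ℕ.≤-trans i≤n (ℕ.m≤n+m _ m)) ⟩
    d ^ (suc m ℕ.+ _ ∸ l) * binom _ l        ∎
    where open ≡-Reasoning

  taylorCoeff-powP-linear : ∀ {c a d} → c + a ≡ d → ∀ i l →
    taylorCoeff (powP (c ∷ a ∷ []) i) l ≡ a ^ l * (d ^ (i ∸ l) * binom i l)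
  taylorCoeff-powP-linear c+a≡d zero zero    = refl
  taylorCoeff-powP-linear {a = a} c+a≡d zero (suc l) = sym (ℚ.*-zeroʳ (a ^ suc l))
  taylorCoeff-powP-linear {c} {a} {d} c+a≡d (suc i) zero = begin
    taylorCoeff ((c ∷ a ∷ []) ⊛ R) 0
      ≡⟨ taylorCoeff-linear-⊛ c a R 0 ⟩
    c * taylorCoeff R 0 + a * (0ℚ + taylorCoeff R 0)
      ≡⟨ collect c a (taylorCoeff R 0) ⟩
    (c + a) * taylorCoeff R 0
      ≡⟨ cong₂ _*_ c+a≡d (taylorCoeff-powP-linear c+a≡d i 0) ⟩
    d * (1ℚ * (d ^ i * 1ℚ))
      ≡⟨ reassoc d (d ^ i) ⟩
    1ℚ * ((d * d ^ i) * 1ℚ)  ∎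
    where
    open ≡-Reasoning
    R : Poly
    R = powP (c ∷ a ∷ []) i
    collect : ∀ c a t → c * t + a * (0ℚ + t) ≡ (c + a) * t
    collect = solve-∀ ℚ-ring
    reassoc : ∀ d D → d * (1ℚ * (D * 1ℚ)) ≡ 1ℚ * ((d * D) * 1ℚ)
    reassoc = solve-∀ ℚ-ring
  taylorCoeff-powP-linear {c} {a} {d} c+a≡d (suc i) (suc l) = begin
    taylorCoeff ((c ∷ a ∷ []) ⊛ R) (suc l)
      ≡⟨ taylorCoeff-linear-⊛ c a R (suc l) ⟩
    c * T₁ + a * (T₀ + T₁)
      ≡⟨ collect c a T₀ T₁ ⟩
    (c + a) * T₁ + a * T₀
      ≡⟨ cong₂ _+_ (cong₂ _*_ c+a≡d (taylorCoeff-powP-linear c+a≡d i (suc l)))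
                   (cong (a *_) (taylorCoeff-powP-linear c+a≡d i l)) ⟩
    d * (a * A * D₁) + a * (A * D₀)
      ≡⟨ cong (_+ a * (A * D₀)) (pull d (a * A) (d ^ (i ∸ suc l)) (binom i (suc l))) ⟩
    (a * A) * (d * (d ^ (i ∸ suc l) * binom i (suc l))) + a * (A * D₀)
      ≡⟨ cong (λ t → (a * A) * t + a * (A * D₀)) (*-^-∸-binom d (suc l) ℕ.≤-refl) ⟩
    (a * A) * (d ^ (i ∸ l) * binom i (suc l)) + a * (A * D₀)
      ≡⟨ combine a A (d ^ (i ∸ l)) (binom i l) (binom i (suc l)) ⟩
    (a * A) * (d ^ (i ∸ l) * (binom i l + binom i (suc l)))  ∎
    where
    open ≡-Reasoning
    R : Poly
    R = powP (c ∷ a ∷ []) i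
    T₀ T₁ A D₀ D₁ : ℚ
    T₀ = taylorCoeff R l
    T₁ = taylorCoeff R (suc l)
    A = a ^ l
    D₀ = d ^ (i ∸ l) * binom i l
    D₁ = d ^ (i ∸ suc l) * binom i (suc l)
    collect : ∀ c a t₀ t₁ → c * t₁ + a * (t₀ + t₁) ≡ (c + a) * t₁ + a * t₀
    collect = solve-∀ ℚ-ring
    pull : ∀ d x y z → d * (x * (y * z)) ≡ x * (d * (y * z))
    pull = solve-∀ ℚ-ring
    combine : ∀ a A D b₀ b₁ → (a * A) * (D * b₁) + a * (A * (D * b₀)) ≡ (a * A) * (D * (b₀ + b₁))
    combine = solve-∀ ℚ-ring

  -- The eigenbasis (X − Y)ˡ Yᵏ⁻ˡ

  -- The matrices for which X − Y and Y are eigenvectors; γ⁻¹ M_H γ consists of them.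
  record InConjugateTorus (g : MG) : Set where
    field
      b≡0   : b g ≡ 0ℚ
      c+a≡d : c g + a g ≡ d g

  DegreeBelow-symImg : ∀ k g {i} → i ≤ k → DegreeBelow (suc k) (symImg k g i)
  DegreeBelow-symImg k g {i} i≤k =
    DegreeBelow-mono (symImg k g i) (ℕ.≤-reflexive (trans (ℕ.+-suc i (k ∸ i)) (cong suc (ℕ.m+[n∸m]≡n i≤k))))
      (DegreeBelow-⊛ (powP (c g ∷ a g ∷ []) i) _ (DegreeBelow-powP (c g) (a g) i)
                     (DegreeBelow-powP (d g) (b g) (k ∸ i)))

  taylorCoeff-symImg : ∀ k {g} → InConjugateTorus g → ∀ {i} → i ≤ k → ∀ l →
    taylorCoeff (symImg k g i) l ≡ a g ^ l * (d g ^ (k ∸ l) * binom i l)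
  taylorCoeff-symImg k {g} shape {i} i≤k l = begin
    taylorCoeff (powP (c g ∷ a g ∷ []) i ⊛ powP (d g ∷ b g ∷ []) (k ∸ i)) l
      ≡⟨ taylorCoeff-⊛-constant (d g ^ (k ∸ i)) (taylorCoeff-powP-constant b≡0 (k ∸ i))
                                (powP (c g ∷ a g ∷ []) i) l ⟩
    d g ^ (k ∸ i) * taylorCoeff (powP (c g ∷ a g ∷ []) i) l
      ≡⟨ cong (d g ^ (k ∸ i) *_) (taylorCoeff-powP-linear c+a≡d i l) ⟩
    d g ^ (k ∸ i) * (a g ^ l * (d g ^ (i ∸ l) * binom i l))
      ≡⟨ swap (d g ^ (k ∸ i)) (a g ^ l) _ ⟩
    a g ^ l * (d g ^ (k ∸ i) * (d g ^ (i ∸ l) * binom i l))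
      ≡⟨ cong (a g ^ l *_) (^-*-^-∸-binom (d g) (k ∸ i) l ℕ.≤-refl) ⟩
    a g ^ l * (d g ^ (k ∸ i ℕ.+ i ∸ l) * binom i l)
      ≡⟨ cong (λ n → a g ^ l * (d g ^ (n ∸ l) * binom i l)) (ℕ.m∸n+n≡m i≤k) ⟩
    a g ^ l * (d g ^ (k ∸ l) * binom i l)  ∎
    where
    open ≡-Reasoning
    open InConjugateTorus shape
    swap : ∀ x y z → x * (y * z) ≡ y * (x * z)
    swap = solve-∀ ℚ-ring

  taylorCoord : ∀ {k} → ℕ → Vec ℚ (suc k) → ℚ
  taylorCoord {k} l v = ∑[ j < suc k ] (lookup v j * binom (toℕ j) l)

  taylorCoord-addV : ∀ {k} l (u v : Vec ℚ (suc k)) →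
    taylorCoord l (addV u v) ≡ taylorCoord l u + taylorCoord l v
  taylorCoord-addV {k} l u v = begin
    ∑[ j < suc k ] (lookup (addV u v) j * binom (toℕ j) l)
      ≡⟨ sum-cong-≗ {suc k} (λ j →
           trans (cong (_* binom (toℕ j) l) (lookup∘tabulate (λ j → lookup u j + lookup v j) j))
                 (ℚ.*-distribʳ-+ (binom (toℕ j) l) (lookup u j) (lookup v j))) ⟩
    ∑[ j < suc k ] (lookup u j * binom (toℕ j) l + lookup v j * binom (toℕ j) l)
      ≡⟨ ∑-distrib-+ {suc k} (λ j → lookup u j * binom (toℕ j) l) (λ j → lookup v j * binom (toℕ j) l) ⟩
    taylorCoord l u + taylorCoord l v  ∎
    where open ≡-Reasoning

  taylorCoord-scaleV : ∀ {k} l x (v : Vec ℚ (suc k)) → taylorCoord l (scaleV x v) ≡ x * taylorCoord l v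
  taylorCoord-scaleV {k} l x v = begin
    ∑[ j < suc k ] (lookup (scaleV x v) j * binom (toℕ j) l)
      ≡⟨ sum-cong-≗ {suc k} (λ j →
           trans (cong (_* binom (toℕ j) l) (lookup∘tabulate (λ j → x * lookup v j) j))
                 (ℚ.*-assoc x (lookup v j) (binom (toℕ j) l))) ⟩
    ∑[ j < suc k ] (x * (lookup v j * binom (toℕ j) l))
      ≡⟨ *-distribˡ-sum {suc k} x (λ j → lookup v j * binom (toℕ j) l) ⟨
    x * taylorCoord l v  ∎
    where open ≡-Reasoning

  taylorCoord-combination : ∀ {k} (w : Fin (suc k) → ℚ) (P : Fin (suc k) → Poly) →
    (∀ i → DegreeBelow (suc k) (P i)) → ∀ l →
    taylorCoord {k} l (tabulate (λ j → sumF (λ i → w i * coeff (P i) (toℕ j))))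
      ≡ ∑[ i < suc k ] (w i * taylorCoeff (P i) l)
  taylorCoord-combination {k} w P deg l = begin
    ∑[ j < suc k ] (lookup (tabulate (λ j → sumF (λ i → W i j))) j * B j)
      ≡⟨ sum-cong-≗ {suc k} (λ j →
           cong (_* B j) (trans (lookup∘tabulate (λ j → sumF (λ i → W i j)) j) (sumF≡sum (λ i → W i j)))) ⟩
    ∑[ j < suc k ] (∑[ i < suc k ] W i j * B j)
      ≡⟨ sum-cong-≗ {suc k} (λ j → *-distribʳ-sum {suc k} (B j) (λ i → W i j)) ⟩
    ∑[ j < suc k ] ∑[ i < suc k ] (W i j * B j)
      ≡⟨ ∑-comm {suc k} {suc k} (λ j i → W i j * B j) ⟩
    ∑[ i < suc k ] ∑[ j < suc k ] (W i j * B j)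
      ≡⟨ sum-cong-≗ {suc k} (λ i → sum-cong-≗ {suc k} (λ j → ℚ.*-assoc (w i) (coeff (P i) (toℕ j)) (B j))) ⟩
    ∑[ i < suc k ] ∑[ j < suc k ] (w i * (coeff (P i) (toℕ j) * B j))
      ≡⟨ sum-cong-≗ {suc k} (λ i → *-distribˡ-sum {suc k} (w i) (λ j → coeff (P i) (toℕ j) * B j)) ⟨
    ∑[ i < suc k ] (w i * ∑[ j < suc k ] (coeff (P i) (toℕ j) * B j))
      ≡⟨ sum-cong-≗ {suc k} (λ i → cong (w i *_) (taylorCoeff-binomial-sum (P i) (deg i) l)) ⟩
    ∑[ i < suc k ] (w i * taylorCoeff (P i) l)  ∎
    where
    open ≡-Reasoning
    W : Fin (suc k) → Fin (suc k) → ℚ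
    W i j = w i * coeff (P i) (toℕ j)
    B : Fin (suc k) → ℚ
    B j = binom (toℕ j) l

  taylorCoord-symAct : ∀ k {g} → InConjugateTorus g → ∀ l (v : Vec ℚ (suc k)) →
    taylorCoord l (symAct k g v) ≡ (a g ^ l * d g ^ (k ∸ l)) * taylorCoord l v
  taylorCoord-symAct k {g} shape l v = begin
    taylorCoord l (symAct k g v)
      ≡⟨ taylorCoord-combination (lookup v) (symImg k g ∘ toℕ)
                                 (λ i → DegreeBelow-symImg k g (Finₚ.toℕ≤pred[n] i)) l ⟩
    ∑[ i < suc k ] (lookup v i * taylorCoeff (symImg k g (toℕ i)) l)
      ≡⟨ sum-cong-≗ {suc k} (λ i → cong (lookup v i *_) (taylorCoeff-symImg k shape (Finₚ.toℕ≤pred[n] i) l)) ⟩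
    ∑[ i < suc k ] (lookup v i * (a g ^ l * (d g ^ (k ∸ l) * binom (toℕ i) l)))
      ≡⟨ sum-cong-≗ {suc k} (λ i → reassoc (lookup v i) (a g ^ l) (d g ^ (k ∸ l)) (binom (toℕ i) l)) ⟩
    ∑[ i < suc k ] ((a g ^ l * d g ^ (k ∸ l)) * (lookup v i * binom (toℕ i) l))
      ≡⟨ *-distribˡ-sum {suc k} (a g ^ l * d g ^ (k ∸ l)) (λ i → lookup v i * binom (toℕ i) l) ⟨
    (a g ^ l * d g ^ (k ∸ l)) * taylorCoord l v  ∎
    where
    open ≡-Reasoning
    reassoc : ∀ v A D c → v * (A * (D * c)) ≡ (A * D) * (v * c)
    reassoc = solve-∀ ℚ-ring

  vecP : ∀ k → Poly → Vec ℚ (suc k)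
  vecP k p = tabulate (λ j → coeff p (toℕ j))

  taylorCoord-vecP : ∀ k p → DegreeBelow (suc k) p → ∀ l → taylorCoord l (vecP k p) ≡ taylorCoeff p l
  taylorCoord-vecP k p deg l =
    trans (sum-cong-≗ {suc k} (λ j → cong (_* binom (toℕ j) l) (lookup∘tabulate (coeff p ∘ toℕ) j)))
          (taylorCoeff-binomial-sum p deg l)

  coeff-toList : ∀ {n} (v : Vec ℚ n) j → coeff (toList v) (toℕ j) ≡ lookup v j
  coeff-toList (x ∷ᵥ v) fzero    = refl
  coeff-toList (x ∷ᵥ v) (fsuc j) = coeff-toList v j

  vecP-toList : ∀ k (v : Vec ℚ (suc k)) → vecP k (toList v) ≡ v
  vecP-toList k v = trans (tabulate-cong (coeff-toList v)) (tabulate∘lookup v)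

  DegreeBelow-toList : ∀ {n} (v : Vec ℚ n) → DegreeBelow n (toList v)
  DegreeBelow-toList []ᵥ       m       _       = refl
  DegreeBelow-toList (x ∷ᵥ v) (suc m) (s≤s n≤m) = DegreeBelow-toList v m n≤m

  mulXMinus1 : Poly → Poly
  mulXMinus1 p = (0ℚ ∷ p) ⊕ scaleP (- 1ℚ) p

  mulXMinus1^ : ℕ → Poly → Poly
  mulXMinus1^ zero    p = p
  mulXMinus1^ (suc r) p = mulXMinus1 (mulXMinus1^ r p)

  xMinus1^ : ℕ → Poly
  xMinus1^ l = mulXMinus1^ l (1ℚ ∷ [])

  mulXMinus1^-suc : ∀ r p → mulXMinus1^ r (mulXMinus1 p) ≡ mulXMinus1^ (suc r) p
  mulXMinus1^-suc zero    p = refl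
  mulXMinus1^-suc (suc r) p = cong mulXMinus1 (mulXMinus1^-suc r p)

  coeff-mulXMinus1 : ∀ p n → coeff (mulXMinus1 p) n ≡ coeff (0ℚ ∷ p) n + - 1ℚ * coeff p n
  coeff-mulXMinus1 p n =
    trans (coeff-⊕ (0ℚ ∷ p) (scaleP (- 1ℚ) p) n) (cong (_+_ (coeff (0ℚ ∷ p) n)) (coeff-scaleP (- 1ℚ) p n))

  coeff-cons-split : ∀ a p n → coeff (a ∷ p) n ≡ a * coeff (1ℚ ∷ []) n + coeff (p ⊕ mulXMinus1 p) n
  coeff-cons-split a p n = sym (begin
    a * coeff (1ℚ ∷ []) n + coeff (p ⊕ mulXMinus1 p) n
      ≡⟨ cong (_+_ (a * coeff (1ℚ ∷ []) n)) (coeff-⊕ p (mulXMinus1 p) n) ⟩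
    a * coeff (1ℚ ∷ []) n + (coeff p n + coeff (mulXMinus1 p) n)
      ≡⟨ cong (λ t → a * coeff (1ℚ ∷ []) n + (coeff p n + t)) (coeff-mulXMinus1 p n) ⟩
    a * coeff (1ℚ ∷ []) n + (coeff p n + (coeff (0ℚ ∷ p) n + - 1ℚ * coeff p n))
      ≡⟨ collapse n ⟩
    coeff (a ∷ p) n  ∎)
    where
    open ≡-Reasoning
    collapse : ∀ n →
      a * coeff (1ℚ ∷ []) n + (coeff p n + (coeff (0ℚ ∷ p) n + - 1ℚ * coeff p n)) ≡ coeff (a ∷ p) n
    collapse zero    = cancel a (coeff p 0)
      where
      cancel : ∀ a c → a * 1ℚ + (c + (0ℚ + - 1ℚ * c)) ≡ a
      cancel = solve-∀ ℚ-ring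
    collapse (suc n) = cancel a (coeff p n) (coeff p (suc n))
      where
      cancel : ∀ a c c′ → a * 0ℚ + (c′ + (c + - 1ℚ * c′)) ≡ c
      cancel = solve-∀ ℚ-ring

  coeff-mulXMinus1^-[] : ∀ r n → coeff (mulXMinus1^ r []) n ≡ 0ℚ
  coeff-mulXMinus1^-[] zero    n = refl
  coeff-mulXMinus1^-[] (suc r) n = trans (coeff-mulXMinus1 (mulXMinus1^ r []) n)
    (cong₂ _+_ (shifted n) (trans (cong (- 1ℚ *_) (coeff-mulXMinus1^-[] r n)) (ℚ.*-zeroʳ (- 1ℚ))))
    where
    shifted : ∀ n → coeff (0ℚ ∷ mulXMinus1^ r []) n ≡ 0ℚ
    shifted zero    = refl
    shifted (suc n) = coeff-mulXMinus1^-[] r n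

  mulXMinus1^-linear : ∀ r {a p q s} → (∀ n → coeff p n ≡ a * coeff q n + coeff s n) →
    ∀ n → coeff (mulXMinus1^ r p) n ≡ a * coeff (mulXMinus1^ r q) n + coeff (mulXMinus1^ r s) n
  mulXMinus1^-linear zero    rel n = rel n
  mulXMinus1^-linear (suc r) {a} {p} {q} {s} rel n = begin
    coeff (mulXMinus1 P) n
      ≡⟨ coeff-mulXMinus1 P n ⟩
    coeff (0ℚ ∷ P) n + - 1ℚ * coeff P n
      ≡⟨ cong₂ _+_ (shifted n) (cong (- 1ℚ *_) (rel′ n)) ⟩
    (a * coeff (0ℚ ∷ Q) n + coeff (0ℚ ∷ S) n) + - 1ℚ * (a * coeff Q n + coeff S n)
      ≡⟨ regroup a (coeff (0ℚ ∷ Q) n) (coeff (0ℚ ∷ S) n) (coeff Q n) (coeff S n) ⟩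
    a * (coeff (0ℚ ∷ Q) n + - 1ℚ * coeff Q n) + (coeff (0ℚ ∷ S) n + - 1ℚ * coeff S n)
      ≡⟨ cong₂ _+_ (cong (a *_) (coeff-mulXMinus1 Q n)) (coeff-mulXMinus1 S n) ⟨
    a * coeff (mulXMinus1 Q) n + coeff (mulXMinus1 S) n  ∎
    where
    open ≡-Reasoning
    P Q S : Poly
    P = mulXMinus1^ r p
    Q = mulXMinus1^ r q
    S = mulXMinus1^ r s
    rel′ : ∀ n → coeff P n ≡ a * coeff Q n + coeff S n
    rel′ = mulXMinus1^-linear r {a} {p} {q} {s} rel
    shifted : ∀ n → coeff (0ℚ ∷ P) n ≡ a * coeff (0ℚ ∷ Q) n + coeff (0ℚ ∷ S) n
    shifted zero    = sym (trans (cong (_+ 0ℚ) (ℚ.*-zeroʳ a)) (ℚ.+-identityʳ 0ℚ))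
    shifted (suc n) = rel′ n
    regroup : ∀ a x y u v → (a * x + y) + - 1ℚ * (a * u + v) ≡ a * (x + - 1ℚ * u) + (y + - 1ℚ * v)
    regroup = solve-∀ ℚ-ring

  taylorCoeff-mulXMinus1-zero : ∀ p → taylorCoeff (mulXMinus1 p) 0 ≡ 0ℚ
  taylorCoeff-mulXMinus1-zero p = begin
    taylorCoeff (mulXMinus1 p) 0
      ≡⟨ taylorCoeff-⊕ (0ℚ ∷ p) (scaleP (- 1ℚ) p) 0 ⟩
    (0ℚ + taylorCoeff p 0) + taylorCoeff (scaleP (- 1ℚ) p) 0
      ≡⟨ cong (_+_ (0ℚ + taylorCoeff p 0)) (taylorCoeff-scaleP (- 1ℚ) p 0) ⟩
    (0ℚ + taylorCoeff p 0) + - 1ℚ * taylorCoeff p 0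
      ≡⟨ cancel (taylorCoeff p 0) ⟩
    0ℚ  ∎
    where
    open ≡-Reasoning
    cancel : ∀ t → (0ℚ + t) + - 1ℚ * t ≡ 0ℚ
    cancel = solve-∀ ℚ-ring

  taylorCoeff-mulXMinus1-suc : ∀ p l → taylorCoeff (mulXMinus1 p) (suc l) ≡ taylorCoeff p l
  taylorCoeff-mulXMinus1-suc p l = begin
    taylorCoeff (mulXMinus1 p) (suc l)
      ≡⟨ taylorCoeff-⊕ (0ℚ ∷ p) (scaleP (- 1ℚ) p) (suc l) ⟩
    (taylorCoeff p l + taylorCoeff p (suc l)) + taylorCoeff (scaleP (- 1ℚ) p) (suc l)
      ≡⟨ cong (_+_ (taylorCoeff p l + taylorCoeff p (suc l))) (taylorCoeff-scaleP (- 1ℚ) p (suc l)) ⟩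
    (taylorCoeff p l + taylorCoeff p (suc l)) + - 1ℚ * taylorCoeff p (suc l)
      ≡⟨ cancel (taylorCoeff p l) (taylorCoeff p (suc l)) ⟩
    taylorCoeff p l  ∎
    where
    open ≡-Reasoning
    cancel : ∀ t u → (t + u) + - 1ℚ * u ≡ t
    cancel = solve-∀ ℚ-ring

  taylorCoeff-xMinus1^-diag : ∀ l → taylorCoeff (xMinus1^ l) l ≡ 1ℚ
  taylorCoeff-xMinus1^-diag zero    = refl
  taylorCoeff-xMinus1^-diag (suc l) = trans (taylorCoeff-mulXMinus1-suc (xMinus1^ l) l) (taylorCoeff-xMinus1^-diag l)

  taylorCoeff-xMinus1^-off : ∀ {m l} → m ≢ l → taylorCoeff (xMinus1^ l) m ≡ 0ℚ
  taylorCoeff-xMinus1^-off {zero}  {zero}  m≢l = ⊥-elim (m≢l refl)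
  taylorCoeff-xMinus1^-off {suc m} {zero}  m≢l = refl
  taylorCoeff-xMinus1^-off {zero}  {suc l} m≢l = taylorCoeff-mulXMinus1-zero (xMinus1^ l)
  taylorCoeff-xMinus1^-off {suc m} {suc l} m≢l =
    trans (taylorCoeff-mulXMinus1-suc (xMinus1^ l) m) (taylorCoeff-xMinus1^-off (m≢l ∘ cong suc))

  DegreeBelow-xMinus1^ : ∀ l → DegreeBelow (suc l) (xMinus1^ l)
  DegreeBelow-xMinus1^ zero    (suc n) _            = refl
  DegreeBelow-xMinus1^ (suc l) (suc n) (s≤s l<n) = begin
    coeff (mulXMinus1 (xMinus1^ l)) (suc n)
      ≡⟨ coeff-mulXMinus1 (xMinus1^ l) (suc n) ⟩
    coeff (xMinus1^ l) n + - 1ℚ * coeff (xMinus1^ l) (suc n)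
      ≡⟨ cong₂ _+_ (DegreeBelow-xMinus1^ l n l<n)
                   (cong (- 1ℚ *_) (DegreeBelow-xMinus1^ l (suc n) (ℕ.m≤n⇒m≤1+n l<n))) ⟩
    0ℚ + - 1ℚ * 0ℚ
      ≡⟨⟩
    0ℚ  ∎
    where open ≡-Reasoning

  basis : ∀ k → ℕ → Vec ℚ (suc k)
  basis k l = vecP k (xMinus1^ l)

  taylorCoord-basis-diag : ∀ {k l} → l ≤ k → taylorCoord l (basis k l) ≡ 1ℚ
  taylorCoord-basis-diag {k} {l} l≤k =
    trans (taylorCoord-vecP k (xMinus1^ l) (DegreeBelow-mono (xMinus1^ l) (s≤s l≤k) (DegreeBelow-xMinus1^ l)) l)
          (taylorCoeff-xMinus1^-diag l)

  taylorCoord-basis-off : ∀ {k l} → l ≤ k → ∀ {m} → m ≢ l → taylorCoord m (basis k l) ≡ 0ℚ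
  taylorCoord-basis-off {k} {l} l≤k {m} m≢l =
    trans (taylorCoord-vecP k (xMinus1^ l) (DegreeBelow-mono (xMinus1^ l) (s≤s l≤k) (DegreeBelow-xMinus1^ l)) m)
          (taylorCoeff-xMinus1^-off m≢l)

  module LinearFunctional {k} (φ : Vec ℚ (suc k) → ℚ)
    (additive : ∀ u v → φ (addV u v) ≡ φ u + φ v)
    (homogeneous : ∀ x v → φ (scaleV x v) ≡ x * φ v) where

    φ-vecP-linear : ∀ {a p q s} → (∀ n → coeff p n ≡ a * coeff q n + coeff s n) →
      φ (vecP k p) ≡ a * φ (vecP k q) + φ (vecP k s)
    φ-vecP-linear {a} {p} {q} {s} rel = begin
      φ (vecP k p)
        ≡⟨ cong φ (tabulate-cong entry) ⟩
      φ (addV (scaleV a (vecP k q)) (vecP k s))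
        ≡⟨ additive _ _ ⟩
      φ (scaleV a (vecP k q)) + φ (vecP k s)
        ≡⟨ cong (_+ φ (vecP k s)) (homogeneous a (vecP k q)) ⟩
      a * φ (vecP k q) + φ (vecP k s)  ∎
      where
      open ≡-Reasoning
      entry : ∀ j → coeff p (toℕ j) ≡ lookup (scaleV a (vecP k q)) j + lookup (vecP k s) j
      entry j = trans (rel (toℕ j)) (sym (cong₂ _+_
        (trans (lookup∘tabulate (λ j → a * lookup (vecP k q) j) j)
               (cong (a *_) (lookup∘tabulate (coeff q ∘ toℕ) j)))
        (lookup∘tabulate (coeff s ∘ toℕ) j)))

    φ-mulXMinus1^-linear : ∀ r a p q s → (∀ n → coeff p n ≡ a * coeff q n + coeff s n) →
      φ (vecP k (mulXMinus1^ r p)) ≡ a * φ (vecP k (mulXMinus1^ r q)) + φ (vecP k (mulXMinus1^ r s))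
    φ-mulXMinus1^-linear r a p q s rel =
      φ-vecP-linear {a} {mulXMinus1^ r p} {mulXMinus1^ r q} {mulXMinus1^ r s} (mulXMinus1^-linear r {a} {p} {q} {s} rel)

    φ-vecP-zero : ∀ {p} → (∀ n → coeff p n ≡ 0ℚ) → φ (vecP k p) ≡ 0ℚ
    φ-vecP-zero {p} p≡0 = begin
      φ (vecP k p)                 ≡⟨ cong φ (tabulate-cong entry) ⟩
      φ (scaleV 0ℚ (vecP k p))     ≡⟨ homogeneous 0ℚ (vecP k p) ⟩
      0ℚ * φ (vecP k p)            ≡⟨ ℚ.*-zeroˡ (φ (vecP k p)) ⟩
      0ℚ                           ∎
      where
      open ≡-Reasoning
      entry : ∀ j → coeff p (toℕ j) ≡ 0ℚ * lookup (vecP k p) j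
      entry j = trans (p≡0 (toℕ j)) (sym (ℚ.*-zeroˡ (lookup (vecP k p) j)))

    expansion-shifted : ∀ p {N} → length p ≤ N → ∀ r →
      φ (vecP k (mulXMinus1^ r p)) ≡ ∑[ l < N ] (taylorCoeff p (toℕ l) * φ (basis k (toℕ l ℕ.+ r)))
    expansion-shifted []      {N}     _            r =
      trans (φ-vecP-zero {mulXMinus1^ r []} (coeff-mulXMinus1^-[] r))
        (sym (sum-zero {N} (λ l → 0ℚ * φ (basis k (toℕ l ℕ.+ r)))
                           (λ l → ℚ.*-zeroˡ (φ (basis k (toℕ l ℕ.+ r))))))
    expansion-shifted (a ∷ p) {suc N} (s≤s len≤N) r = begin
      Φ (mulXMinus1^ r (a ∷ p))
        ≡⟨ φ-mulXMinus1^-linear r a (a ∷ p) (1ℚ ∷ []) (p ⊕ mulXMinus1 p) (coeff-cons-split a p) ⟩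
      a * F r + Φ (mulXMinus1^ r (p ⊕ mulXMinus1 p))
        ≡⟨ cong (_+_ (a * F r)) (φ-mulXMinus1^-linear r 1ℚ (p ⊕ mulXMinus1 p) p (mulXMinus1 p) split-⊕) ⟩
      a * F r + (1ℚ * Φ (mulXMinus1^ r p) + Φ (mulXMinus1^ r (mulXMinus1 p)))
        ≡⟨ cong (λ t → a * F r + (1ℚ * Φ (mulXMinus1^ r p) + Φ t)) (mulXMinus1^-suc r p) ⟩
      a * F r + (1ℚ * Φ (mulXMinus1^ r p) + Φ (mulXMinus1^ (suc r) p))
        ≡⟨ cong (λ t → a * F r + t)
                (cong₂ (λ u v → 1ℚ * u + v) (expansion-shifted p (ℕ.m≤n⇒m≤1+n len≤N) r) shifted-IH) ⟩
      a * F r + (1ℚ * (T 0 * F r + X) + Y)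
        ≡⟨ regroup a (T 0) (F r) X Y ⟩
      (a + T 0) * F r + (Y + X)
        ≡⟨ cong (_+_ ((a + T 0) * F r)) merge ⟩
      (a + T 0) * F r + ∑[ l < N ] ((T (toℕ l) + T (suc (toℕ l))) * F′ (toℕ l))  ∎
      where
      open ≡-Reasoning
      Φ : Poly → ℚ
      Φ p = φ (vecP k p)
      T : ℕ → ℚ
      T = taylorCoeff p
      F F′ : ℕ → ℚ
      F l = φ (basis k l)
      F′ l = F (suc l ℕ.+ r)
      X Y : ℚ
      X = ∑[ l < N ] (T (suc (toℕ l)) * F′ (toℕ l))
      Y = ∑[ l < N ] (T (toℕ l) * F′ (toℕ l))
      merge : Y + X ≡ ∑[ l < N ] ((T (toℕ l) + T (suc (toℕ l))) * F′ (toℕ l))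
      merge = sym (trans (sum-cong-≗ {N} (λ l → ℚ.*-distribʳ-+ (F′ (toℕ l)) (T (toℕ l)) (T (suc (toℕ l)))))
                         (∑-distrib-+ {N} (λ l → T (toℕ l) * F′ (toℕ l)) _))
      split-⊕ : ∀ n → coeff (p ⊕ mulXMinus1 p) n ≡ 1ℚ * coeff p n + coeff (mulXMinus1 p) n
      split-⊕ n =
        trans (coeff-⊕ p (mulXMinus1 p) n) (cong (_+ coeff (mulXMinus1 p) n) (sym (ℚ.*-identityˡ (coeff p n))))
      shifted-IH : Φ (mulXMinus1^ (suc r) p) ≡ Y
      shifted-IH = trans (expansion-shifted p len≤N (suc r))
        (sum-cong-≗ {N} (λ l → cong (λ n → T (toℕ l) * F n) (ℕ.+-suc (toℕ l) r)))
      regroup : ∀ a t f x y → a * f + (1ℚ * (t * f + x) + y) ≡ (a + t) * f + (y + x)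
      regroup = solve-∀ ℚ-ring

    expansion : ∀ v → φ v ≡ ∑[ l < suc k ] (taylorCoord (toℕ l) v * φ (basis k (toℕ l)))
    expansion v = begin
      φ v
        ≡⟨ cong φ (vecP-toList k v) ⟨
      φ (vecP k (toList v))
        ≡⟨ expansion-shifted (toList v) (ℕ.≤-reflexive (length-toList v)) 0 ⟩
      ∑[ l < suc k ] (taylorCoeff (toList v) (toℕ l) * φ (basis k (toℕ l ℕ.+ 0)))
        ≡⟨ sum-cong-≗ {suc k} (λ l → cong₂ _*_ (coord l) (cong (φ ∘ basis k) (ℕ.+-identityʳ (toℕ l)))) ⟩
      ∑[ l < suc k ] (taylorCoord (toℕ l) v * φ (basis k (toℕ l)))  ∎
      where
      open ≡-Reasoning
      coord : ∀ l → taylorCoeff (toList v) (toℕ l) ≡ taylorCoord (toℕ l) v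
      coord l = trans (sym (taylorCoord-vecP k (toList v) (DegreeBelow-toList v) (toℕ l)))
                      (cong (taylorCoord (toℕ l)) (vecP-toList k v))

    module _ (T : Vec ℚ (suc k) → Vec ℚ (suc k)) (μ : ℕ → ℚ) (λ₀ : ℚ)
      (T-coord : ∀ m v → taylorCoord m (T v) ≡ μ m * taylorCoord m v)
      (φ-eigen : ∀ v → φ (T v) ≡ λ₀ * φ v) where

      basis-eigen : ∀ {l} → l ≤ k → μ l * φ (basis k l) ≡ λ₀ * φ (basis k l)
      basis-eigen {l} l≤k = begin
        μ l * φ (basis k l)
          ≡⟨ cong (_* φ (basis k l)) (ℚ.*-identityʳ (μ l)) ⟨
        (μ l * 1ℚ) * φ (basis k l)
          ≡⟨ cong (λ t → (μ l * t) * φ (basis k l)) (taylorCoord-basis-diag l≤k) ⟨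
        (μ l * taylorCoord l (basis k l)) * φ (basis k l)
          ≡⟨ sum-single (λ m → (μ m * taylorCoord m (basis k l)) * φ (basis k m)) l (s≤s l≤k) off ⟨
        ∑[ m < suc k ] ((μ (toℕ m) * taylorCoord (toℕ m) (basis k l)) * φ (basis k (toℕ m)))
          ≡⟨ sum-cong-≗ {suc k} (λ m → cong (_* φ (basis k (toℕ m))) (T-coord (toℕ m) (basis k l))) ⟨
        ∑[ m < suc k ] (taylorCoord (toℕ m) (T (basis k l)) * φ (basis k (toℕ m)))
          ≡⟨ expansion (T (basis k l)) ⟨
        φ (T (basis k l))
          ≡⟨ φ-eigen (basis k l) ⟩
        λ₀ * φ (basis k l)  ∎
        where
        open ≡-Reasoning
        off : ∀ m → m < suc k → m ≢ l → (μ m * taylorCoord m (basis k l)) * φ (basis k m) ≡ 0ℚ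
        off m _ m≢l = begin
          (μ m * taylorCoord m (basis k l)) * φ (basis k m)
            ≡⟨ cong (λ t → (μ m * t) * φ (basis k m)) (taylorCoord-basis-off l≤k m≢l) ⟩
          (μ m * 0ℚ) * φ (basis k m)
            ≡⟨ cong (_* φ (basis k m)) (ℚ.*-zeroʳ (μ m)) ⟩
          0ℚ * φ (basis k m)
            ≡⟨ ℚ.*-zeroˡ (φ (basis k m)) ⟩
          0ℚ  ∎

      eigenfunctional-unique : ∀ {i} → i ≤ k → (∀ {l} → l ≤ k → l ≢ i → μ l ≢ λ₀) →
        ∀ v → φ v ≡ φ (basis k i) * taylorCoord i v
      eigenfunctional-unique {i} i≤k separated v = begin
        φ v
          ≡⟨ expansion v ⟩
        ∑[ l < suc k ] (taylorCoord (toℕ l) v * φ (basis k (toℕ l)))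
          ≡⟨ sum-single (λ l → taylorCoord l v * φ (basis k l)) i (s≤s i≤k) off ⟩
        taylorCoord i v * φ (basis k i)
          ≡⟨ ℚ.*-comm (taylorCoord i v) (φ (basis k i)) ⟩
        φ (basis k i) * taylorCoord i v  ∎
        where
        open ≡-Reasoning
        off : ∀ l → l < suc k → l ≢ i → taylorCoord l v * φ (basis k l) ≡ 0ℚ
        off l (s≤s l≤k) l≢i =
          trans (cong (taylorCoord l v *_) (x*z≡y*z⇒z≡0 (φ (basis k l)) (basis-eigen l≤k) (separated l≤k l≢i)))
                (ℚ.*-zeroʳ (taylorCoord l v))

  conjugateTorus : ℚ → ℚ → ℚ → MG
  conjugateTorus x y s = invMG γ · (torus x y s · γ)

  -- The entries of γ⁻¹ are closed terms that compute, so each entry of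
  -- γ⁻¹ · t · γ unfolds to the polynomial on the left of the identities below.
  module _ (x y s : ℚ) where

    conjugateTorus-a : a (conjugateTorus x y s) ≡ s * x
    conjugateTorus-a = entry x y s
      where
      entry : ∀ x y s → 1ℚ * ((s * x) * 1ℚ + 0ℚ * 1ℚ) + 0ℚ * (0ℚ * 1ℚ + (s * y) * 1ℚ) ≡ s * x
      entry = solve-∀ ℚ-ring

    conjugateTorus-d : d (conjugateTorus x y s) ≡ s * y
    conjugateTorus-d = entry x y s
      where
      entry : ∀ x y s → (- 1ℚ) * ((s * x) * 0ℚ + 0ℚ * 1ℚ) + 1ℚ * (0ℚ * 0ℚ + (s * y) * 1ℚ) ≡ s * y
      entry = solve-∀ ℚ-ring

    conjugateTorus-ν : ν (conjugateTorus x y s) ≡ s * s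
    conjugateTorus-ν = entry s
      where
      entry : ∀ s → 1ℚ * ((s * s) * 1ℚ) ≡ s * s
      entry = solve-∀ ℚ-ring

    conjugateTorus-shape : InConjugateTorus (conjugateTorus x y s)
    conjugateTorus-shape = record { b≡0 = entry-b x y s ; c+a≡d = trans (entry-c+a x y s) (sym conjugateTorus-d) }
      where
      entry-b : ∀ x y s → 1ℚ * ((s * x) * 0ℚ + 0ℚ * 1ℚ) + 0ℚ * (0ℚ * 0ℚ + (s * y) * 1ℚ) ≡ 0ℚ
      entry-b = solve-∀ ℚ-ring
      entry-c+a : ∀ x y s →
        ((- 1ℚ) * ((s * x) * 1ℚ + 0ℚ * 1ℚ) + 1ℚ * (0ℚ * 1ℚ + (s * y) * 1ℚ))
          + (1ℚ * ((s * x) * 1ℚ + 0ℚ * 1ℚ) + 0ℚ * (0ℚ * 1ℚ + (s * y) * 1ℚ)) ≡ s * y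
      entry-c+a = solve-∀ ℚ-ring

    conjugateTorus-det : detA (conjugateTorus x y s) ≡ (s * x) * (s * y)
    conjugateTorus-det = trans
      (cong₂ (λ u v → u + - v) (cong₂ _*_ conjugateTorus-a conjugateTorus-d)
                               (cong (_* c (conjugateTorus x y s)) (InConjugateTorus.b≡0 conjugateTorus-shape)))
      (drop (s * x) (s * y) (c (conjugateTorus x y s)))
      where
      drop : ∀ u v w → u * v + - (0ℚ * w) ≡ u * v
      drop = solve-∀ ℚ-ring

  module _ {x y s : ℚ} (x≢0 : x ≢ 0ℚ) (y≢0 : y ≢ 0ℚ) (s≢0 : s ≢ 0ℚ) where

    private
      χ : ℤ → ℤ → ℤ → ℚ
      χ e₁ e₂ e₃ = character e₁ e₂ e₃ x y s

      χ-cong : ∀ {e₁ e₂ e₃ f₁ f₂ f₃} → e₁ ≡ f₁ → e₂ ≡ f₂ → e₃ ≡ f₃ → χ e₁ e₂ e₃ ≡ χ f₁ f₂ f₃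
      χ-cong refl refl refl = refl

    character-homo : ∀ e₁ e₂ e₃ f₁ f₂ f₃ →
      χ e₁ e₂ e₃ * χ f₁ f₂ f₃ ≡ χ (e₁ ℤ.+ f₁) (e₂ ℤ.+ f₂) (e₃ ℤ.+ f₃)
    character-homo e₁ e₂ e₃ f₁ f₂ f₃ = trans
      (regroup (zpow x e₁) (zpow y e₂) (zpow s e₃) (zpow x f₁) (zpow y f₂) (zpow s f₃))
      (sym (cong₂ _*_ (zpow-homo-+ e₁ f₁ x≢0)
                      (cong₂ _*_ (zpow-homo-+ e₂ f₂ y≢0) (zpow-homo-+ e₃ f₃ s≢0))))
      where
      regroup : ∀ a b c a′ b′ c′ → (a * (b * c)) * (a′ * (b′ * c′)) ≡ (a * a′) * ((b * b′) * (c * c′))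
      regroup = solve-∀ ℚ-ring

    zpow-sx : ∀ n → zpow (s * x) n ≡ χ n 0ℤ n
    zpow-sx n = trans (zpow-distrib-* n s≢0 x≢0) (swap (zpow s n) (zpow x n))
      where
      swap : ∀ a b → a * b ≡ b * (1ℚ * a)
      swap = solve-∀ ℚ-ring

    zpow-sy : ∀ n → zpow (s * y) n ≡ χ 0ℤ n n
    zpow-sy n = trans (zpow-distrib-* n s≢0 y≢0) (swap (zpow s n) (zpow y n))
      where
      swap : ∀ a b → a * b ≡ 1ℚ * (b * a)
      swap = solve-∀ ℚ-ring

    zpow-ss : ∀ n → zpow (s * s) n ≡ χ 0ℤ 0ℤ (n ℤ.+ n)
    zpow-ss n = trans (zpow-distrib-* n s≢0 s≢0)
      (trans (sym (zpow-homo-+ n n s≢0)) (sym (trans (ℚ.*-identityˡ _) (ℚ.*-identityˡ _))))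

    -- The eigenvalue of (X − Y)ⁱ Yʲ ⊗ detᵠ ⊗ νʰ under γ⁻¹ diag(sx, sy) γ, as a character.
    torus-weight : ∀ q h i j →
      zpow ((s * x) * (s * y)) q * zpow (s * s) h * ((s * x) ^ i * (s * y) ^ j)
        ≡ χ (q ℤ.+ + i) (q ℤ.+ + j) ((q ℤ.+ + i) ℤ.+ (q ℤ.+ + j) ℤ.+ (h ℤ.+ h))
    torus-weight q h i j = begin
      zpow ((s * x) * (s * y)) q * zpow (s * s) h * ((s * x) ^ i * (s * y) ^ j)
        ≡⟨ cong₂ _*_ (cong₂ _*_ (trans (zpow-distrib-* q sx≢0 sy≢0) (cong₂ _*_ (zpow-sx q) (zpow-sy q)))
                                (zpow-ss h))
                     (cong₂ _*_ (zpow-sx (+ i)) (zpow-sy (+ j))) ⟩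
      (χ q 0ℤ q * χ 0ℤ q q) * χ 0ℤ 0ℤ (h ℤ.+ h) * (χ (+ i) 0ℤ (+ i) * χ 0ℤ (+ j) (+ j))
        ≡⟨ cong₂ _*_ (trans (cong (_* χ 0ℤ 0ℤ (h ℤ.+ h)) (character-homo q 0ℤ q 0ℤ q q))
                            (character-homo (q ℤ.+ 0ℤ) (0ℤ ℤ.+ q) (q ℤ.+ q) 0ℤ 0ℤ (h ℤ.+ h)))
                     (character-homo (+ i) 0ℤ (+ i) 0ℤ (+ j) (+ j)) ⟩
      χ (q ℤ.+ 0ℤ ℤ.+ 0ℤ) (0ℤ ℤ.+ q ℤ.+ 0ℤ) (q ℤ.+ q ℤ.+ (h ℤ.+ h))
        * χ (+ i ℤ.+ 0ℤ) (0ℤ ℤ.+ + j) (+ i ℤ.+ + j)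
        ≡⟨ character-homo (q ℤ.+ 0ℤ ℤ.+ 0ℤ) (0ℤ ℤ.+ q ℤ.+ 0ℤ) (q ℤ.+ q ℤ.+ (h ℤ.+ h))
                          (+ i ℤ.+ 0ℤ) (0ℤ ℤ.+ + j) (+ i ℤ.+ + j) ⟩
      χ (q ℤ.+ 0ℤ ℤ.+ 0ℤ ℤ.+ (+ i ℤ.+ 0ℤ)) (0ℤ ℤ.+ q ℤ.+ 0ℤ ℤ.+ (0ℤ ℤ.+ + j))
        (q ℤ.+ q ℤ.+ (h ℤ.+ h) ℤ.+ (+ i ℤ.+ + j))
        ≡⟨ χ-cong (exp₁ q (+ i)) (exp₂ q (+ j)) (exp₃ q h (+ i) (+ j)) ⟩
      χ (q ℤ.+ + i) (q ℤ.+ + j) ((q ℤ.+ + i) ℤ.+ (q ℤ.+ + j) ℤ.+ (h ℤ.+ h))  ∎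
      where
      open ≡-Reasoning
      sx≢0 : s * x ≢ 0ℚ
      sx≢0 = *-≢0 s≢0 x≢0
      sy≢0 : s * y ≢ 0ℚ
      sy≢0 = *-≢0 s≢0 y≢0
      exp₁ : ∀ q i → q ℤ.+ 0ℤ ℤ.+ 0ℤ ℤ.+ (i ℤ.+ 0ℤ) ≡ q ℤ.+ i
      exp₁ = ℤ-Solver.solve-∀
      exp₂ : ∀ q j → 0ℤ ℤ.+ q ℤ.+ 0ℤ ℤ.+ (0ℤ ℤ.+ j) ≡ q ℤ.+ j
      exp₂ = ℤ-Solver.solve-∀
      exp₃ : ∀ q h i j → q ℤ.+ q ℤ.+ (h ℤ.+ h) ℤ.+ (i ℤ.+ j) ≡ (q ℤ.+ i) ℤ.+ (q ℤ.+ j) ℤ.+ (h ℤ.+ h)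
      exp₃ = ℤ-Solver.solve-∀

  -- Branching to characters of γ⁻¹ T γ

  UniqueHomUpToScalar : (p q r e₁ e₂ e₃ : ℤ) → Set
  UniqueHomUpToScalar p q r e₁ e₂ e₃ =
    Σ (Vec ℚ (suc (dimG p q)) → ℚ) (λ φ₀ →
      IsHom p q r e₁ e₂ e₃ φ₀
      × ∃ (λ v → φ₀ v ≢ 0ℚ)
      × ((φ : Vec ℚ (suc (dimG p q)) → ℚ) → IsHom p q r e₁ e₂ e₃ φ →
         ∃ (λ x → ∀ v → φ v ≡ x * φ₀ v)))

  module _ (p q r : ℤ) where

    private
      k : ℕ
      k = dimG p q
      h : ℤ
      h = halfExp p q r

    scalarPart : MG → ℚ
    scalarPart g = zpow (detA g) q * zpow (ν g) h

    eigenvalue : MG → ℕ → ℚ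
    eigenvalue g l = scalarPart g * (a g ^ l * d g ^ (k ∸ l))

    taylorCoord-ρG : ∀ {g} → InConjugateTorus g → ∀ l v →
      taylorCoord l (ρG p q r g v) ≡ eigenvalue g l * taylorCoord l v
    taylorCoord-ρG {g} shape l v = begin
      taylorCoord l (scaleV (scalarPart g) (symAct k g v))
        ≡⟨ taylorCoord-scaleV l (scalarPart g) (symAct k g v) ⟩
      scalarPart g * taylorCoord l (symAct k g v)
        ≡⟨ cong (scalarPart g *_) (taylorCoord-symAct k shape l v) ⟩
      scalarPart g * ((a g ^ l * d g ^ (k ∸ l)) * taylorCoord l v)
        ≡⟨ ℚ.*-assoc (scalarPart g) _ _ ⟨
      eigenvalue g l * taylorCoord l v  ∎
      where open ≡-Reasoning

    module _ (t₁ t₂ : ℤ) (i j : ℕ) (k≡i+j : dimG p q ≡ i ℕ.+ j)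
      (q+i≡t₁ : q ℤ.+ + i ≡ t₁) (q+j≡t₂ : q ℤ.+ + j ≡ t₂)
      (weight : t₁ ℤ.+ t₂ ℤ.+ (halfExp p q r ℤ.+ halfExp p q r) ≡ r) where

      private
        i≤k : i ℕ.≤ k
        i≤k = subst (i ℕ.≤_) (sym k≡i+j) (ℕ.m≤m+n i j)

        k∸i≡j : k ∸ i ≡ j
        k∸i≡j = trans (cong (_∸ i) k≡i+j) (ℕ.m+n∸m≡n i j)

      eigenvalue-character : ∀ {x y s} → x ≢ 0ℚ → y ≢ 0ℚ → s ≢ 0ℚ →
        eigenvalue (conjugateTorus x y s) i ≡ character t₁ t₂ r x y s
      eigenvalue-character {x} {y} {s} x≢0 y≢0 s≢0 = begin
        eigenvalue (conjugateTorus x y s) i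
          ≡⟨ cong₂ _*_ (cong₂ _*_ (cong (λ z → zpow z q) (conjugateTorus-det x y s))
                                  (cong (λ z → zpow z h) (conjugateTorus-ν x y s)))
                       (cong₂ _*_ (cong (_^ i) (conjugateTorus-a x y s))
                                  (cong₂ _^_ (conjugateTorus-d x y s) k∸i≡j)) ⟩
        zpow ((s * x) * (s * y)) q * zpow (s * s) h * ((s * x) ^ i * (s * y) ^ j)
          ≡⟨ torus-weight x≢0 y≢0 s≢0 q h i j ⟩
        character (q ℤ.+ + i) (q ℤ.+ + j) ((q ℤ.+ + i) ℤ.+ (q ℤ.+ + j) ℤ.+ (h ℤ.+ h)) x y s
          ≡⟨ cong₂ (λ e₁ e₂ → character e₁ e₂ (e₁ ℤ.+ e₂ ℤ.+ (h ℤ.+ h)) x y s) q+i≡t₁ q+j≡t₂ ⟩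
        character t₁ t₂ (t₁ ℤ.+ t₂ ℤ.+ (h ℤ.+ h)) x y s
          ≡⟨ cong (λ e → character t₁ t₂ e x y s) weight ⟩
        character t₁ t₂ r x y s  ∎
        where open ≡-Reasoning

      taylorCoord-isHom : IsHom p q r t₁ t₂ r (taylorCoord i)
      taylorCoord-isHom = record
        { additive    = taylorCoord-addV i
        ; homogeneous = taylorCoord-scaleV i
        ; equivariant = λ x y s x≢0 y≢0 s≢0 v →
            trans (taylorCoord-ρG (conjugateTorus-shape x y s) i v)
                  (cong (_* taylorCoord i v) (eigenvalue-character x≢0 y≢0 s≢0))
        }

      private
        g₀ : MG
        g₀ = conjugateTorus two 1ℚ 1ℚ

        scalarPart-g₀≢0 : scalarPart g₀ ≢ 0ℚ
        scalarPart-g₀≢0 = *-≢0 (zpow-≢0 q (λ ())) (zpow-≢0 h (λ ()))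

        eigenvalue-g₀ : ∀ l → eigenvalue g₀ l ≡ scalarPart g₀ * two ^ l
        eigenvalue-g₀ l =
          cong (scalarPart g₀ *_) (trans (cong (two ^ l *_) (^-zeroˡ (k ∸ l))) (ℚ.*-identityʳ (two ^ l)))

        separated : ∀ {l} → l ℕ.≤ k → l ≢ i → eigenvalue g₀ l ≢ character t₁ t₂ r two 1ℚ 1ℚ
        separated {l} _ l≢i eq = l≢i (two^-injective (*-cancelˡ-≢0 (scalarPart g₀) scalarPart-g₀≢0 (begin
          scalarPart g₀ * two ^ l          ≡⟨ eigenvalue-g₀ l ⟨
          eigenvalue g₀ l                  ≡⟨ eq ⟩
          character t₁ t₂ r two 1ℚ 1ℚ      ≡⟨ eigenvalue-character two≢0 ℚ.1≢0 ℚ.1≢0 ⟨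
          eigenvalue g₀ i                  ≡⟨ eigenvalue-g₀ i ⟩
          scalarPart g₀ * two ^ i          ∎)))
          where open ≡-Reasoning

      branching : UniqueHomUpToScalar p q r t₁ t₂ r
      branching = taylorCoord i , taylorCoord-isHom , (basis k i , nonzero) , unique
        where
        nonzero : taylorCoord i (basis k i) ≢ 0ℚ
        nonzero eq = ℚ.1≢0 (trans (sym (taylorCoord-basis-diag i≤k)) eq)
        unique : (φ : Vec ℚ (suc k) → ℚ) → IsHom p q r t₁ t₂ r φ →
          ∃ (λ x → ∀ v → φ v ≡ x * taylorCoord i v)
        unique φ hom = φ (basis k i) ,
          eigenfunctional-unique (ρG p q r g₀) (eigenvalue g₀) (character t₁ t₂ r two 1ℚ 1ℚ)
            (taylorCoord-ρG (conjugateTorus-shape two 1ℚ 1ℚ)) (equivariant two 1ℚ 1ℚ two≢0 ℚ.1≢0 ℚ.1≢0)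
            i≤k separated
          where
          open IsHom hom
          open LinearFunctional φ additive homogeneous


open import Data.Integer using (ℤ; +_; -[1+_]; _+_; _-_; -_; _≤_; ∣_∣)
import Data.Integer.DivMod as ℤ
import Data.Integer.Properties as ℤ
import Data.Integer.Tactic.RingSolver as ℤ-Solver
import Data.Nat as ℕ
import Data.Nat.DivMod as ℕ
import Data.Nat.Properties as ℕ
open import Data.Nat using (suc)
open import Data.Product using (Σ; ∃; _×_; _,_)
open import Data.Rational using (ℚ; 0ℚ) renaming (_*_ to _*ℚ_)
open import Data.Vec using (Vec)
open import Function using (_∘_)
open import Relation.Binary.PropositionalEquality

halfExp-double : ∀ p q r n → r - p - q ≡ + n + + n → halfExp p q r ≡ + n
halfExp-double p q r n eq = begin
  (r - p - q) ℤ./ + 2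
    ≡⟨ cong (ℤ._/ + 2) eq ⟩
  + (n ℕ.+ n) ℤ./ + 2
    ≡⟨ ℤ.div-pos-is-/ℕ (+ (n ℕ.+ n)) 2 ⟩
  + ((n ℕ.+ n) ℕ./ 2)
    ≡⟨ cong (λ m → + (m ℕ./ 2)) (trans (cong (n ℕ.+_) (sym (ℕ.+-identityʳ n))) (ℕ.*-comm 2 n)) ⟩
  + ((n ℕ.* 2) ℕ./ 2)
    ≡⟨ cong +_ (ℕ.m*n/n≡m n 2) ⟩
  + n  ∎
  where open ≡-Reasoning

halfExp-κ₁ : ∀ {r₁ r₂} → -[1+ 0 ] ≤ r₂ → halfExp r₁ (- r₂ - + 2) (r₁ + r₂) ≡ r₂ + + 1
halfExp-κ₁ {r₁} {r₂} r₂≥-1 =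
  trans (halfExp-double r₁ (- r₂ - + 2) (r₁ + r₂) ∣ r₂ + + 1 ∣
          (trans (double r₁ r₂) (cong₂ _+_ (sym n≡r₂+1) (sym n≡r₂+1))))
        n≡r₂+1
  where
  n≡r₂+1 : + ∣ r₂ + + 1 ∣ ≡ r₂ + + 1
  n≡r₂+1 = ℤ.0≤i⇒+∣i∣≡i (ℤ.+-monoˡ-≤ (+ 1) r₂≥-1)
  double : ∀ r₁ r₂ → (r₁ + r₂) - r₁ - (- r₂ - + 2) ≡ (r₂ + + 1) + (r₂ + + 1)
  double = ℤ-Solver.solve-∀

+∣t-q∣≡t-q : ∀ {r₂ t} → -[1+ 0 ] ≤ r₂ → -[1+ 0 ] ≤ t → + ∣ t - (- r₂ - + 2) ∣ ≡ t - (- r₂ - + 2)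
+∣t-q∣≡t-q {r₂} {t} r₂≥-1 t≥-1 =
  ℤ.0≤i⇒+∣i∣≡i (subst (+ 0 ≤_) (sym (shift t r₂))
                      (ℤ.+-mono-≤ (ℤ.+-monoˡ-≤ (+ 1) t≥-1) (ℤ.+-monoˡ-≤ (+ 1) r₂≥-1)))
  where
  shift : ∀ t r₂ → t - (- r₂ - + 2) ≡ (t + + 1) + (r₂ + + 1)
  shift = ℤ-Solver.solve-∀

r₁-q≡[t₁-q]+[t₂-q] : ∀ {r₁ r₂ t₁ t₂} → t₁ + t₂ ≡ r₁ - r₂ - + 2 →
  r₁ - (- r₂ - + 2) ≡ (t₁ - (- r₂ - + 2)) + (t₂ - (- r₂ - + 2))
r₁-q≡[t₁-q]+[t₂-q] {r₁} {r₂} {t₁} {t₂} t₁+t₂≡r₁-r₂-2 = begin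
  r₁ - (- r₂ - + 2)                           ≡⟨ expand r₁ r₂ ⟩
  (r₁ - r₂ - + 2) + (r₂ + r₂ + + 4)           ≡⟨ cong (_+ (r₂ + r₂ + + 4)) t₁+t₂≡r₁-r₂-2 ⟨
  (t₁ + t₂) + (r₂ + r₂ + + 4)                 ≡⟨ regroup t₁ t₂ r₂ ⟩
  (t₁ - (- r₂ - + 2)) + (t₂ - (- r₂ - + 2))   ∎
  where
  open ≡-Reasoning
  expand : ∀ r₁ r₂ → r₁ - (- r₂ - + 2) ≡ (r₁ - r₂ - + 2) + (r₂ + r₂ + + 4)
  expand = ℤ-Solver.solve-∀
  regroup : ∀ t₁ t₂ r₂ → (t₁ + t₂) + (r₂ + r₂ + + 4) ≡ (t₁ - (- r₂ - + 2)) + (t₂ - (- r₂ - + 2))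
  regroup = ℤ-Solver.solve-∀

mainTheorem4 : (r₁ r₂ t₁ t₂ : ℤ) → r₂ ≤ r₁ → -[1+ 0 ] ≤ r₂
    → -[1+ 0 ] ≤ t₁ → -[1+ 0 ] ≤ t₂ → t₁ + t₂ ≡ r₁ - r₂ - + 2
    → Σ (Vec ℚ (suc (dimG r₁ (- r₂ - + 2))) → ℚ) (λ φ₀ →
        IsHom r₁ (- r₂ - + 2) (r₁ + r₂) t₁ t₂ (r₁ + r₂) φ₀
        × ∃ (λ v → φ₀ v ≢ 0ℚ)
        × ((φ : Vec ℚ (suc (dimG r₁ (- r₂ - + 2))) → ℚ)
           → IsHom r₁ (- r₂ - + 2) (r₁ + r₂) t₁ t₂ (r₁ + r₂) φ
           → ∃ (λ x → ∀ v → φ v ≡ x *ℚ φ₀ v)))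
mainTheorem4 r₁ r₂ t₁ t₂ _ r₂≥-1 t₁≥-1 t₂≥-1 t₁+t₂≡r₁-r₂-2 =
  branching r₁ q (r₁ + r₂) t₁ t₂ ∣ t₁ - q ∣ ∣ t₂ - q ∣ k≡i+j (q+i≡t t₁≥-1) (q+i≡t t₂≥-1) weight
  where
  q : ℤ
  q = - r₂ - + 2

  q+i≡t : ∀ {t} → -[1+ 0 ] ≤ t → q + + ∣ t - q ∣ ≡ t
  q+i≡t {t} t≥-1 = trans (cong (λ n → q + n) (+∣t-q∣≡t-q r₂≥-1 t≥-1)) (cancel q t)
    where
    cancel : ∀ q t → q + (t - q) ≡ t
    cancel = ℤ-Solver.solve-∀

  k≡i+j : ∣ r₁ - q ∣ ≡ ∣ t₁ - q ∣ ℕ.+ ∣ t₂ - q ∣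
  k≡i+j = cong ∣_∣ (trans (r₁-q≡[t₁-q]+[t₂-q] {r₁} {r₂} {t₁} {t₂} t₁+t₂≡r₁-r₂-2)
    (sym (cong₂ _+_ (+∣t-q∣≡t-q r₂≥-1 t₁≥-1) (+∣t-q∣≡t-q r₂≥-1 t₂≥-1))))

  weight : t₁ + t₂ + (halfExp r₁ q (r₁ + r₂) + halfExp r₁ q (r₁ + r₂)) ≡ r₁ + r₂
  weight = trans (cong₂ (λ u h → u + (h + h)) t₁+t₂≡r₁-r₂-2 (halfExp-κ₁ {r₁} r₂≥-1)) (collect r₁ r₂)
    where
    collect : ∀ r₁ r₂ → (r₁ - r₂ - + 2) + ((r₂ + + 1) + (r₂ + + 1)) ≡ r₁ + r₂
    collect = ℤ-Solver.solve-∀
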